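{- Let $P$ be a pattern of length $m$ with minimum CT-block-period $p\le m/4$, and let $T$ be a text of length $n$. The exact CT-occurrences of $P$ in $T$ can be partitioned into $\mathcal{O}(n/m)$ maximal arithmetic progressions with common difference $p$. For each such progression $\{u+vp: v\in[0,z]\}$, the fragment $T[u\mathinner{.\,.} u+zp+m)$ is a CT-run with minimum CT-block-period $p$. For any two such progressions $\{u_1+vp:v\in[0,z_1]\}$ and $\{u_2+vp:v\in[0,z_2]\}$, the runs $T[u_1\mathinner{.\,.} u_1+z_1p+m)$ and $T[u_2\mathinner{.\,.} u_2+z_2p+m)$ overlap by fewer than $p$ positions.
   Context: Strings are over a totally ordered alphabet; $X[i]$ is the $i$-th character (1-indexed); $X[i\mathinner{.\,.} j]$ denotes $X[i]\cdots X[j]$ and $X[i\mathinner{.\,.} j)$ denotes $X[i]\cdots X[j-1]$. The leftmost minimum of a nonempty string $S$ is $S[t]$ for the smallest index $t$ at which the minimum value occurs. The Cartesian tree $\mathsf{CT}(S)$: empty for the empty string; otherwise a root with left subtree $\mathsf{CT}(S[1\mathinner{.\,.} t-1])$ and right subtree $\mathsf{CT}(S[t+1\mathinner{.\,.} |S|])$, where $S[t]$ is the leftmost minimum. $S\approx S'$ iff $\mathsf{CT}(S)=\mathsf{CT}(S')$. A position $i\in[1,n-m+1]$ is an (exact) CT-occurrence of $P$ in $T$ if $P\approx T[i\mathinner{.\,.} i+m)$. A string $S[1\mathinner{.\,.} \ell]$ has CT-border-period $p\in[1,\ell]$ iff $S[1\mathinner{.\,.} \ell-p]\approx S[p+1\mathinner{.\,.}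 \ell]$; it has CT-block-period $p$ iff $p$ divides $\ell$, $p$ is a CT-border-period of $S$, and the leftmost minimum of $S$ is $S[1]$ or $S[\ell]$; the minimum CT-block-period is the smallest such $p$. A fragment $X[i\mathinner{.\,.} j]$ with minimum CT-block-period $p\le (j-i+1)/2$ is a CT-run iff $p$ is not a CT-block-period of $X[i-p\mathinner{.\,.} j]$ (or $i-p<1$) and $p$ is not a CT-block-period of $X[i\mathinner{.\,.} j+p]$ (or $j+p>|X|$). -}

module Defs where

open import Level using (0ℓ)
open import Data.Nat using (ℕ; zero; suc; _+_; _*_; _∸_; _≤_; _<_; _⊓_; _⊔_)
open import Data.Nat.Divisibility using (_∣_)
open import Data.Empty using (⊥)
open import Data.List using (List; []; _∷_; length; take; drop)
open import Data.Product using (Σ; _×_; _,_; proj₁; proj₂)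
open import Data.Sum using (_⊎_)
open import Relation.Nullary using (¬_)
open import Relation.Binary.Bundles using (StrictTotalOrder)
open import Relation.Binary.Definitions using (tri<; tri≈; tri>)
open import Relation.Binary.PropositionalEquality using (_≡_)

-- Shapes of Cartesian trees (unlabelled binary trees).
data Tree : Set where
  leaf : Tree
  node : Tree → Tree → Tree

module CT (O : StrictTotalOrder 0ℓ 0ℓ 0ℓ) where
  open StrictTotalOrder O using (compare) renaming (Carrier to A)

  String : Set
  String = List A

  -- lm x xs = (value, 0-based index) of the leftmost minimum of x ∷ xs
  lm : A → List A → A × ℕ
  lm x [] = x , 0
  lm x (y ∷ ys) with lm y ys
  ... | v , t with compare v x
  ...   | tri< _ _ _ = v , suc t
  ...   | tri≈ _ _ _ = x , 0
  ...   | tri> _ _ _ = x , 0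

  -- Cartesian tree, with fuel (the length suffices).
  ctF : ℕ → String → Tree
  ctF zero _ = leaf
  ctF (suc k) [] = leaf
  ctF (suc k) (x ∷ xs) =
    let t = proj₂ (lm x xs) in
    node (ctF k (take t (x ∷ xs))) (ctF k (drop (suc t) (x ∷ xs)))

  CTree : String → Tree
  CTree S = ctF (length S) S

  _≈CT_ : String → String → Set
  S ≈CT S' = CTree S ≡ CTree S'

  -- X[i .. j] (1-indexed, inclusive); intended for 1 ≤ i.
  sub : String → ℕ → ℕ → String
  sub X i j = take (suc j ∸ i) (drop (i ∸ 1) X)

  Occ : String → String → ℕ → Set
  Occ P T i = 1 ≤ i × i + length P ≤ length T + 1 × (P ≈CT sub T i (i + length P ∸ 1))

  BorderPeriod : String → ℕ → Set
  BorderPeriod S p = 1 ≤ p × p ≤ length S × (take (length S ∸ p) S ≈CT drop p S)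

  LMinAtEnd : String → Set
  LMinAtEnd [] = ⊥
  LMinAtEnd (x ∷ xs) = proj₂ (lm x xs) ≡ 0 ⊎ proj₂ (lm x xs) ≡ length xs

  BlockPeriod : String → ℕ → Set
  BlockPeriod S p = p ∣ length S × BorderPeriod S p × LMinAtEnd S

  MinBlockPeriod : String → ℕ → Set
  MinBlockPeriod S p = BlockPeriod S p × (∀ q → BlockPeriod S q → p ≤ q)

  IsRun : String → ℕ → ℕ → ℕ → Set
  IsRun X i j p =
    1 ≤ i × i ≤ j × j ≤ length X ×
    MinBlockPeriod (sub X i j) p × 2 * p ≤ suc j ∸ i ×
    (i ≤ p ⊎ ¬ BlockPeriod (sub X (i ∸ p) j) p) ×
    (length X < j + p ⊎ ¬ BlockPeriod (sub X i (j + p)) p)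

  InAP : ℕ → ℕ → ℕ → ℕ → Set
  InAP p u z i = Σ ℕ λ v → v ≤ z × i ≡ u + v * p

  MaxAP : String → String → ℕ → ℕ × ℕ → Set
  MaxAP P T p (u , z) =
    (∀ v → v ≤ z → Occ P T (u + v * p)) ×
    (∀ w → w + p ≡ u → ¬ Occ P T w) ×
    ¬ Occ P T (u + suc z * p)

  Disjoint : ℕ → ℕ × ℕ → ℕ × ℕ → Set
  Disjoint p (u₁ , z₁) (u₂ , z₂) = ∀ i → InAP p u₁ z₁ i → ¬ InAP p u₂ z₂ i

  SmallOverlap : ℕ → ℕ → ℕ × ℕ → ℕ × ℕ → Set
  SmallOverlap m p (u₁ , z₁) (u₂ , z₂) =
    ((u₁ + z₁ * p + m) ⊓ (u₂ + z₂ * p + m)) ∸ (u₁ ⊔ u₂) < p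

{-# OPTIONS --safe #-}
-- A string is handled through the strict total order on its positions (compare characters,
-- break ties to the left); two windows are CT-equivalent iff every interval has the same least
-- position in both. Suppose the minimum of P is its first character, so every occurrence of P
-- begins with its own minimum. Two occurrences whose distance is a multiple of p and which
-- overlap in more than p positions then glue into one window with CT-border-period p.
-- Conversely, occurrences at distance d with d + p ≤ m force p ∣ d: otherwise Euclid's
-- algorithm on the CT-border-periods p and d of P yields a CT-block-period of P below p. Hence
-- the occurrences split into maximal progressions of difference p whose spans are CT-runs
-- overlapping in fewer than p positions, and consecutive progressions start more than
-- m − p ≥ m/2 apart, so there are at most 2n/m of them. A pattern whose minimum is its last
-- character is reduced to this case by mirroring P and T.

module Submission where

open import Defs
open import Level using (0ℓ)
open import Function using (_∘_; id)
open import Data.Nat hiding (compare)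
open import Data.Nat.Properties
open import Data.Nat.Divisibility
  using (_∣_; divides; ∣-refl; ∣-trans; ∣⇒≤; ∣m∸n∣n⇒∣m; ∣m+n∣m⇒∣n; ∣m∣n⇒∣m+n; n∣m*n)
open import Data.Nat.DivMod using (_/_; _%_; m≡m%n+[m/n]*n; m%n<n)
open import Data.Nat.Tactic.RingSolver using (solve-∀)
open import Data.List using (List; []; _∷_; length; take; drop; map; filter; upTo)
open import Data.List.Properties using (length-take; length-drop; length-map)
open import Data.List.Relation.Unary.All as All using (All; []; _∷_)
open import Data.List.Relation.Unary.All.Properties as All using (all-filter)
open import Data.List.Relation.Unary.Any as Any using (Any)
open import Data.List.Relation.Unary.Any.Properties as Any using ()
open import Data.List.Relation.Unary.AllPairs as AllPairs using (AllPairs; []; _∷_)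
open import Data.List.Relation.Unary.AllPairs.Properties as AllPairs using ()
open import Data.List.Membership.Propositional using (_∈_)
open import Data.List.Membership.Propositional.Properties using (∈-filter⁺; ∈-upTo⁺)
open import Data.Product using (Σ; ∃; _×_; _,_; proj₁; proj₂)
open import Data.Sum using (_⊎_; inj₁; inj₂)
open import Data.Empty using (⊥; ⊥-elim)
open import Relation.Nullary using (¬_; yes; no; _×-dec_)
open import Relation.Unary using (Pred; Decidable)
open import Relation.Binary.Core using (Rel)
open import Relation.Binary.Definitions using (tri<; tri≈; tri>; DecidableEquality)
open import Relation.Binary.Bundles using (StrictTotalOrder)
open import Relation.Binary.PropositionalEquality

variable
  R S U : Rel ℕ 0ℓ
  a b c a′ b′ c′ k ℓ n p q u : ℕ

<∸⇒+< : b < ℓ ∸ p → b + p < ℓ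
<∸⇒+< {b} {ℓ} {p} b<ℓ-p with p ≤? ℓ
... | yes p≤ℓ = subst (b + p <_) (m∸n+n≡m p≤ℓ) (+-monoˡ-< p b<ℓ-p)
... | no p≰ℓ = ⊥-elim (n≮0 (subst (b <_) (m≤n⇒m∸n≡0 (<⇒≤ (≰⇒> p≰ℓ))) b<ℓ-p))

+<⇒<∸ : b + p < ℓ → b < ℓ ∸ p
+<⇒<∸ {b} = m+n≤o⇒m≤o∸n (suc b)

-- Position orders and Cartesian-tree equivalence

-- Working with arbitrary orders on positions, rather than strings, lets mirror images
-- (`mirror`) be handled by the same lemmas.
record IsPositionOrder (R : Rel ℕ 0ℓ) : Set where
  field
    irreflexive : ∀ x → ¬ R x x
    transitive  : ∀ {x y z} → R x y → R y z → R x z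
    connected   : ∀ x y → x ≢ y → R x y ⊎ R y x

open IsPositionOrder public

record ArgMin (R : Rel ℕ 0ℓ) (a b c : ℕ) : Set where
  constructor argMin
  field
    lower : a ≤ c
    upper : c ≤ b
    least : ∀ k → a ≤ k → k ≤ b → k ≢ c → R c k

open ArgMin public

argMin-unique : IsPositionOrder R → ArgMin R a b c → ArgMin R a b c′ → c ≡ c′
argMin-unique {c = c} {c′ = c′} R-ord m m′ with c ≟ c′
... | yes c≡c′ = c≡c′
... | no c≢c′ = ⊥-elim (irreflexive R-ord c (transitive R-ord
        (least m c′ (lower m′) (upper m′) (c≢c′ ∘ sym)) (least m′ c (lower m) (upper m) c≢c′)))

argMin-singleton : ArgMin R a a a
argMin-singleton = argMin ≤-refl ≤-refl λ k a≤k k≤a k≢a → ⊥-elim (k≢a (≤-antisym k≤a a≤k))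

argMin-snoc-keep : ArgMin R a b c → R c (suc b) → ArgMin R a (suc b) c
argMin-snoc-keep {R = R} {a = a} {b = b} {c = c} m c<b+1 = argMin (lower m) (m≤n⇒m≤1+n (upper m)) least′
  where
  least′ : ∀ k → a ≤ k → k ≤ suc b → k ≢ c → R c k
  least′ k a≤k k≤b+1 k≢c with m≤n⇒m<n∨m≡n k≤b+1
  ... | inj₁ k≤b = least m k a≤k (s≤s⁻¹ k≤b) k≢c
  ... | inj₂ refl = c<b+1

argMin-snoc-new : IsPositionOrder R → ArgMin R a b c → R (suc b) c → ArgMin R a (suc b) (suc b)
argMin-snoc-new {R = R} {a = a} {b = b} {c = c} R-ord m b+1<c =
  argMin (m≤n⇒m≤1+n (≤-trans (lower m) (upper m))) ≤-refl least′
  where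
  least′ : ∀ k → a ≤ k → k ≤ suc b → k ≢ suc b → R (suc b) k
  least′ k a≤k k≤b+1 k≢b+1 with k ≟ c
  ... | yes refl = b+1<c
  ... | no k≢c = transitive R-ord b+1<c
                   (least m k a≤k (s≤s⁻¹ (≤∧≢⇒< k≤b+1 k≢b+1)) k≢c)

argMin-exists : IsPositionOrder R → a ≤ b → ∃ (ArgMin R a b)
argMin-exists {b = zero} R-ord z≤n = 0 , argMin-singleton
argMin-exists {b = suc b} R-ord a≤b+1 with m≤n⇒m<n∨m≡n a≤b+1
... | inj₂ refl = suc b , argMin-singleton
... | inj₁ a≤b with argMin-exists R-ord (s≤s⁻¹ a≤b)
...   | c , m with connected R-ord c (suc b) (λ c≡b+1 → 1+n≰n (subst (_≤ b) c≡b+1 (upper m)))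
...     | inj₁ c<b+1 = c , argMin-snoc-keep m c<b+1
...     | inj₂ b+1<c = suc b , argMin-snoc-new R-ord m b+1<c

argMin-map : (∀ {x y} → a ≤ x → x ≤ b → a ≤ y → y ≤ b → R x y → S x y) →
             ArgMin R a b c → ArgMin S a b c
argMin-map f m = argMin (lower m) (upper m)
  λ k a≤k k≤b k≢c → f (lower m) (upper m) a≤k k≤b (least m k a≤k k≤b k≢c)

argMin-≡ : a ≡ a′ → b ≡ b′ → c ≡ c′ → ArgMin R a b c → ArgMin R a′ b′ c′
argMin-≡ refl refl refl m = m

shift : ℕ → Rel ℕ 0ℓ → Rel ℕ 0ℓ
shift t R x y = R (t + x) (t + y)

shift-order : ∀ t → IsPositionOrder R → IsPositionOrder (shift t R)
shift-order t R-ord = record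
  { irreflexive = λ x → irreflexive R-ord (t + x)
  ; transitive  = transitive R-ord
  ; connected   = λ x y x≢y → connected R-ord (t + x) (t + y) (x≢y ∘ +-cancelˡ-≡ t x y)
  }

argMin-shift⁺ : ∀ t → ArgMin (shift t R) a b c → ArgMin R (t + a) (t + b) (t + c)
argMin-shift⁺ {R = R} {a = a} {b = b} {c = c} t m =
  argMin (+-monoʳ-≤ t (lower m)) (+-monoʳ-≤ t (upper m)) least′
  where
  least′ : ∀ k → t + a ≤ k → k ≤ t + b → k ≢ t + c → R (t + c) k
  least′ k t+a≤k k≤t+b k≢t+c with m≤n⇒∃[o]m+o≡n (≤-trans (m≤m+n t _) t+a≤k)
  ... | k′ , refl = least m k′ (+-cancelˡ-≤ t _ _ t+a≤k) (+-cancelˡ-≤ t _ _ k≤t+b) (k≢t+c ∘ cong (t +_))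

argMin-shift⁻ : ∀ t → ArgMin R (t + a) (t + b) (t + c) → ArgMin (shift t R) a b c
argMin-shift⁻ t m = argMin (+-cancelˡ-≤ t _ _ (lower m)) (+-cancelˡ-≤ t _ _ (upper m))
  λ k a≤k k≤b k≢c → least m (t + k) (+-monoʳ-≤ t a≤k) (+-monoʳ-≤ t k≤b) (k≢c ∘ +-cancelˡ-≡ t _ _)

argMin-shift-shift⁺ : ∀ t u → ArgMin (shift t (shift u R)) a b c → ArgMin (shift (u + t) R) a b c
argMin-shift-shift⁺ {R = R} t u =
  argMin-map λ {x} {y} _ _ _ _ → subst₂ R (sym (+-assoc u t x)) (sym (+-assoc u t y))

argMin-shift-shift⁻ : ∀ t u → ArgMin (shift (u + t) R) a b c → ArgMin (shift t (shift u R)) a b c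
argMin-shift-shift⁻ {R = R} t u =
  argMin-map λ {x} {y} _ _ _ _ → subst₂ R (+-assoc u t x) (+-assoc u t y)

argMin-restrict : ∀ {A B} → ArgMin R A B c → A ≤ a → a ≤ c → c ≤ b → b ≤ B → ArgMin R a b c
argMin-restrict m A≤a a≤c c≤b b≤B =
  argMin a≤c c≤b λ k a≤k k≤b k≢c → least m k (≤-trans A≤a a≤k) (≤-trans k≤b b≤B) k≢c

-- The Cartesian tree of an order on [0, n) is determined by the least positions of its
-- intervals, so this is CT-equivalence of the prefixes of length n.
infix 4 _≈[_]_

_≈[_]_ : Rel ℕ 0ℓ → ℕ → Rel ℕ 0ℓ → Set
R ≈[ n ] S = ∀ {a b c} → b < n → ArgMin R a b c → ArgMin S a b c

≈-sym : IsPositionOrder R → IsPositionOrder S → R ≈[ n ] S → S ≈[ n ] R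
≈-sym R-ord S-ord R≈S b<n m with argMin-exists R-ord (≤-trans (lower m) (upper m))
... | c′ , m′ with argMin-unique S-ord m (R≈S b<n m′)
... | refl = m′

≈-trans : R ≈[ n ] S → S ≈[ n ] U → R ≈[ n ] U
≈-trans R≈S S≈U b<n = S≈U b<n ∘ R≈S b<n

≈-weaken : k ≤ n → R ≈[ n ] S → R ≈[ k ] S
≈-weaken k≤n R≈S b<k = R≈S (<-≤-trans b<k k≤n)

≈-shift : ∀ t → R ≈[ n ] S → shift t R ≈[ n ∸ t ] shift t S
≈-shift {R = R} {n = n} {S = S} t R≈S b<n-t =
  argMin-shift⁻ {R = S} t ∘ R≈S (subst (_< n) (+-comm _ t) (<∸⇒+< b<n-t)) ∘ argMin-shift⁺ {R = R} t

≈-shift-shift⁺ : ∀ t u → R ≈[ n ] shift (u + t) S → R ≈[ n ] shift t (shift u S)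
≈-shift-shift⁺ {S = S} t u R≈S b<n = argMin-shift-shift⁻ {R = S} t u ∘ R≈S b<n

≈-shift-shift⁻ : ∀ t u → R ≈[ n ] shift t (shift u S) → R ≈[ n ] shift (u + t) S
≈-shift-shift⁻ {S = S} t u R≈S b<n = argMin-shift-shift⁺ {R = S} t u ∘ R≈S b<n

≈-split-at-min : ∀ {l t} → IsPositionOrder R → ArgMin R 0 l t → ArgMin S 0 l t →
           R ≈[ t ] S → shift (suc t) R ≈[ l ∸ t ] shift (suc t) S → R ≈[ suc l ] S
≈-split-at-min {R = R} {S = S} {l = l} {t} R-ord minR minS before after {a} {b} {c} b<l+1 m
  with b <? t | t <? a
... | yes b<t | _ = before b<t m
... | no _ | yes t<a = beyond t<a m
  where
  beyond : t < a → ArgMin R a b c → ArgMin S a b c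
  beyond t<a m with m≤n⇒∃[o]m+o≡n t<a | m≤n⇒∃[o]m+o≡n (<-≤-trans t<a (≤-trans (lower m) (upper m)))
                  | m≤n⇒∃[o]m+o≡n (<-≤-trans t<a (lower m))
  ... | a′ , refl | b′ , refl | c′ , refl =
    argMin-shift⁺ {R = S} (suc t) (after b′<l-t (argMin-shift⁻ {R = R} (suc t) m))
    where
    b′<l-t : b′ < l ∸ t
    b′<l-t = +<⇒<∸ (subst (_< l) (+-comm t b′) (s≤s⁻¹ b<l+1))
... | no b≮t | no t≮a
  with argMin-unique R-ord m (argMin-restrict minR z≤n (≮⇒≥ t≮a) (≮⇒≥ b≮t) (s≤s⁻¹ b<l+1))
...   | refl = argMin-restrict minS z≤n (≮⇒≥ t≮a) (≮⇒≥ b≮t) (s≤s⁻¹ b<l+1)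

-- Borders

HasBorder : Rel ℕ 0ℓ → ℕ → ℕ → Set
HasBorder R ℓ p = R ≈[ ℓ ∸ p ] shift p R

border-forward : HasBorder R ℓ p → b + p < ℓ → ArgMin R a b c → ArgMin R (p + a) (p + b) (p + c)
border-forward {R = R} {p = p} border b+p<ℓ = argMin-shift⁺ {R = R} p ∘ border (+<⇒<∸ b+p<ℓ)

border-backward : IsPositionOrder R → HasBorder R ℓ p → b + p < ℓ →
                  ArgMin R (p + a) (p + b) (p + c) → ArgMin R a b c
border-backward {p = p} R-ord border b+p<ℓ =
  ≈-sym R-ord (shift-order p R-ord) border (+<⇒<∸ b+p<ℓ) ∘ argMin-shift⁻ p

border-≈ : IsPositionOrder R → IsPositionOrder S → R ≈[ ℓ ] S → HasBorder R ℓ p → HasBorder S ℓ p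
border-≈ {R = R} {S = S} {ℓ = ℓ} {p = p} R-ord S-ord R≈S border b<ℓ-p =
  argMin-shift⁻ {R = S} p ∘ R≈S (subst (_< ℓ) (+-comm _ p) (<∸⇒+< b<ℓ-p)) ∘ argMin-shift⁺ {R = R} p
  ∘ border b<ℓ-p ∘ ≈-sym R-ord S-ord R≈S (<-≤-trans b<ℓ-p (m∸n≤m ℓ p))

MinFrom : Rel ℕ 0ℓ → ℕ → ℕ → Set
MinFrom R ℓ x = ∀ k → x < k → k < ℓ → R x k

minFrom⇒argMin : MinFrom R ℓ a → a ≤ b → b < ℓ → ArgMin R a b a
minFrom⇒argMin min a≤b b<ℓ =
  argMin ≤-refl a≤b λ k a≤k k≤b k≢a → min k (≤∧≢⇒< a≤k (k≢a ∘ sym)) (≤-<-trans k≤b b<ℓ)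

minFrom-≈ : R ≈[ ℓ ] S → MinFrom R ℓ 0 → MinFrom S ℓ 0
minFrom-≈ R≈S min k 0<k k<ℓ =
  least (R≈S k<ℓ (minFrom⇒argMin min z≤n k<ℓ)) k z≤n ≤-refl (>⇒≢ 0<k)

minFrom-step : HasBorder R ℓ p → MinFrom R ℓ a → MinFrom R ℓ (p + a)
minFrom-step {R = R} {ℓ = ℓ} {p = p} {a = a} border min k p+a<k k<ℓ
  with m≤n⇒∃[o]m+o≡n (≤-trans (m≤m+n p a) (<⇒≤ p+a<k))
... | k′ , refl = least shifted (p + k′) (+-monoʳ-≤ p (<⇒≤ a<k′)) ≤-refl (<⇒≢ p+a<k ∘ sym)
  where
  a<k′ : a < k′
  a<k′ = +-cancelˡ-< p a k′ p+a<k
  shifted : ArgMin R (p + a) (p + k′) (p + a)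
  shifted = border-forward border (subst (_< ℓ) (+-comm p k′) k<ℓ)
              (minFrom⇒argMin min (<⇒≤ a<k′) (≤-<-trans (m≤n+m k′ p) k<ℓ))

minFrom-multiple : MinFrom R ℓ 0 → HasBorder R ℓ p → ∀ j → MinFrom R ℓ (j * p)
minFrom-multiple min border zero = min
minFrom-multiple min border (suc j) = minFrom-step border (minFrom-multiple min border j)

minFrom-border : HasBorder R ℓ p → MinFrom R ℓ 0 → MinFrom R ℓ p
minFrom-border {R = R} {ℓ = ℓ} {p = p} border min =
  subst (MinFrom R ℓ) (+-identityʳ p) (minFrom-step border min)

minFrom-shift⁺ : ∀ t → MinFrom (shift t R) ℓ a → MinFrom R (t + ℓ) (t + a)
minFrom-shift⁺ {a = a} t min k t+a<k k<t+ℓ with m≤n⇒∃[o]m+o≡n (≤-trans (m≤m+n t a) (<⇒≤ t+a<k))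
... | k′ , refl = min k′ (+-cancelˡ-< t a k′ t+a<k) (+-cancelˡ-< t k′ _ k<t+ℓ)

minFrom-chain : IsPositionOrder R → MinFrom R ℓ a → a < b → b < ℓ → MinFrom R n b → MinFrom R n a
minFrom-chain {ℓ = ℓ} R-ord minᵃ a<b b<ℓ minᵇ k a<k k<n with k <? ℓ
... | yes k<ℓ = minᵃ k a<k k<ℓ
... | no k≮ℓ = transitive R-ord (minᵃ _ a<b b<ℓ) (minᵇ k (<-≤-trans b<ℓ (≮⇒≥ k≮ℓ)) k<n)

argMin-extendʳ : IsPositionOrder R → MinFrom R ℓ k → a ≤ k → k ≤ b → b < ℓ →
                 ArgMin R a k c → ArgMin R a b c
argMin-extendʳ {R = R} {k = x} {a = a} {b = b} {c = c} R-ord min a≤x x≤b b<ℓ m =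
  argMin (lower m) (≤-trans (upper m) x≤b) least′
  where
  least′ : ∀ k → a ≤ k → k ≤ b → k ≢ c → R c k
  least′ k a≤k k≤b k≢c with k ≤? x
  ... | yes k≤x = least m k a≤k k≤x k≢c
  ... | no k≰x with m≤n⇒m<n∨m≡n (upper m)
  ...   | inj₂ refl = min k (≰⇒> k≰x) (≤-<-trans k≤b b<ℓ)
  ...   | inj₁ c<x = transitive R-ord (least m x a≤x ≤-refl (>⇒≢ c<x))
                                      (min k (≰⇒> k≰x) (≤-<-trans k≤b b<ℓ))

argMin-shrinkʳ : IsPositionOrder R → MinFrom R ℓ k → a ≤ k → k ≤ b → b < ℓ →
                 ArgMin R a b c → ArgMin R a k c
argMin-shrinkʳ R-ord min a≤k k≤b b<ℓ m with argMin-exists R-ord a≤k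
... | c′ , m′ with argMin-unique R-ord m (argMin-extendʳ R-ord min a≤k k≤b b<ℓ m′)
... | refl = m′

border-backward-multiple : IsPositionOrder R → HasBorder R ℓ p → ∀ q → q * p + b < ℓ →
                           ArgMin R (q * p + a) (q * p + b) (q * p + c) → ArgMin R a b c
border-backward-multiple R-ord border zero _ m = m
border-backward-multiple {ℓ = ℓ} {p = p} {b = b} R-ord border (suc q) bound m =
  border-backward-multiple R-ord border q (≤-<-trans (m≤m+n _ p) bound′)
    (border-backward R-ord border bound′ (argMin-≡ (+-assoc p _ _) (+-assoc p _ _) (+-assoc p _ _) m))
  where
  bound′ : q * p + b + p < ℓ
  bound′ = subst (_< ℓ) (trans (+-assoc p (q * p) b) (+-comm p (q * p + b))) bound

private
  inner-window : ∀ {w m} → b < m → w + p + m ≤ ℓ → w + b + p < ℓ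
  inner-window {b = b} {p = p} {w = w} {m} b<m bound = begin-strict
    w + b + p   ≡⟨ +-assoc w b p ⟩
    w + (b + p) ≡⟨ cong (w +_) (+-comm b p) ⟩
    w + (p + b) <⟨ +-monoʳ-< w (+-monoʳ-< p b<m) ⟩
    w + (p + m) ≡⟨ +-assoc w p m ⟨
    w + p + m   ≤⟨ bound ⟩
    _           ∎
    where open ≤-Reasoning

border-transport⁺ : ∀ {w m} → HasBorder R ℓ p → w + p + m ≤ ℓ →
                    S ≈[ m ] shift w R → S ≈[ m ] shift (w + p) R
border-transport⁺ {R = R} {p = p} {w = w} border bound S≈ {a} {b} {c} b<m =
  argMin-shift⁻ {R = R} (w + p) ∘ argMin-≡ (swap a) (swap b) (swap c) ∘
  border-forward border (inner-window {p = p} {w = w} b<m bound) ∘ argMin-shift⁺ {R = R} w ∘ S≈ b<m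
  where
  swap : ∀ x → p + (w + x) ≡ w + p + x
  swap x = trans (sym (+-assoc p w x)) (cong (_+ x) (+-comm p w))

border-transport⁻ : ∀ {w m} → IsPositionOrder R → HasBorder R ℓ p → w + p + m ≤ ℓ →
                    S ≈[ m ] shift (w + p) R → S ≈[ m ] shift w R
border-transport⁻ {R = R} {p = p} {w = w} R-ord border bound S≈ {a} {b} {c} b<m =
  argMin-shift⁻ {R = R} w ∘ border-backward R-ord border (inner-window {p = p} {w = w} b<m bound) ∘
  argMin-≡ (swap a) (swap b) (swap c) ∘ argMin-shift⁺ {R = R} (w + p) ∘ S≈ b<m
  where
  swap : ∀ x → w + p + x ≡ p + (w + x)
  swap x = trans (cong (_+ x) (+-comm w p)) (+-assoc p w x)

-- An interval crossing t
-- is cut at the first multiple of p inside it, which is the minimum of its suffix of the union.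
module Glue {R : Rel ℕ 0ℓ} {p ℓ₁ ℓ₂ j : ℕ} (R-ord : IsPositionOrder R) (0<p : 0 < p)
  (border₁ : HasBorder R ℓ₁ p) (min₁ : MinFrom R ℓ₁ 0)
  (border₂ : HasBorder (shift (j * p) R) ℓ₂ p) (min₂ : MinFrom (shift (j * p) R) ℓ₂ 0)
  (seam≤ℓ₁ : j * p + p ≤ ℓ₁) (seam : R ≈[ suc p ] shift (j * p) R) where

  private
    instance
      p-nonZero : NonZero p
      p-nonZero = >-nonZero 0<p
    t : ℕ
    t = j * p
    L : ℕ
    L = t + ℓ₂

  t<ℓ₁ : t < ℓ₁
  t<ℓ₁ = <-≤-trans (subst (_< t + p) (+-identityʳ t) (+-monoʳ-< t 0<p)) seam≤ℓ₁

  minFrom-t : MinFrom R L t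
  minFrom-t = subst (MinFrom R L) (+-identityʳ t) (minFrom-shift⁺ {R = R} t min₂)

  minFrom-block : ∀ i → MinFrom R L (i * p)
  minFrom-block i with j ≤? i
  ... | yes j≤i = subst (MinFrom R L) t+[i-j]p≡ip
                    (minFrom-shift⁺ {R = R} t (minFrom-multiple min₂ border₂ (i ∸ j)))
    where
    t+[i-j]p≡ip : t + (i ∸ j) * p ≡ i * p
    t+[i-j]p≡ip = trans (sym (*-distribʳ-+ p j (i ∸ j))) (cong (_* p) (m+[n∸m]≡n j≤i))
  ... | no j≰i = minFrom-chain R-ord (minFrom-multiple min₁ border₁ i)
                   (*-monoˡ-< p (≰⇒> j≰i)) t<ℓ₁ minFrom-t

  forward-at-seam : ∀ {q r c} → suc q * p ≡ t → ArgMin R (q * p + r) (suc q * p) c →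
             ArgMin R (p + (q * p + r)) (p + suc q * p) (p + c)
  forward-at-seam {q} {r} {c} [q+1]p≡t m with m≤n⇒∃[o]m+o≡n (≤-trans (m≤m+n (q * p) r) (lower m))
  ... | c′ , refl = argMin-≡ (t+≡p+qp+ r) (trans (+-comm t p) (cong (p +_) (sym [q+1]p≡t)))
                      (t+≡p+qp+ c′) (argMin-shift⁺ t (seam ≤-refl inner))
    where
    inner : ArgMin R r p c′
    inner = border-backward-multiple R-ord border₁ q
              (subst (_< ℓ₁) (trans (sym [q+1]p≡t) (+-comm p (q * p))) t<ℓ₁)
              (argMin-≡ refl (+-comm p (q * p)) refl m)
    t+≡p+qp+ : ∀ x → t + x ≡ p + (q * p + x)
    t+≡p+qp+ x = trans (cong (_+ x) (sym [q+1]p≡t)) (+-assoc p (q * p) x)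

  forward-across-seam : a < t → t ≤ b → b + p < L → ArgMin R a b c → ArgMin R (p + a) (p + b) (p + c)
  forward-across-seam {a} {b} {c} a<t t≤b b+p<L m with a / p | a % p | m≡m%n+[m/n]*n a p | m%n<n a p
  ... | q | r | refl | r<p =
    argMin-extendʳ R-ord (minFrom-block (suc (suc q))) (+-monoʳ-≤ p a≤x) (+-monoʳ-≤ p x≤b)
      (subst (_< L) (+-comm b p) b+p<L) next-block
    where
    x : ℕ
    x = suc q * p
    r+qp≡qp+r : r + q * p ≡ q * p + r
    r+qp≡qp+r = +-comm r (q * p)
    q<j : q < j
    q<j = *-cancelʳ-< p q j (≤-<-trans (m≤n+m (q * p) r) a<t)
    x≤t : x ≤ t
    x≤t = *-monoˡ-≤ p q<j
    a≤x : r + q * p ≤ x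
    a≤x = subst₂ _≤_ (+-comm (q * p) r) (+-comm (q * p) p) (+-monoʳ-≤ (q * p) (<⇒≤ r<p))
    x≤b : x ≤ b
    x≤b = ≤-trans x≤t t≤b
    first-block : ArgMin R (r + q * p) x c
    first-block = argMin-shrinkʳ R-ord (minFrom-block (suc q)) a≤x x≤b (≤-<-trans (m≤m+n b p) b+p<L) m
    next-block : ArgMin R (p + (r + q * p)) (p + x) (p + c)
    next-block with m≤n⇒m<n∨m≡n x≤t
    ... | inj₁ x<t = border-forward border₁ (<-≤-trans x+p<t+1 t<ℓ₁) first-block
      where
      x+p<t+1 : x + p < suc t
      x+p<t+1 = s≤s (subst (_≤ t) (+-comm p x) (*-monoˡ-≤ p (*-cancelʳ-< p (suc q) j x<t)))
    ... | inj₂ x≡t = argMin-≡ (cong (p +_) (sym r+qp≡qp+r)) refl refl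
                       (forward-at-seam {q = q} {r = r} x≡t (argMin-≡ r+qp≡qp+r refl refl first-block))

  forward-after-seam : t ≤ a → b + p < L → ArgMin R a b c → ArgMin R (p + a) (p + b) (p + c)
  forward-after-seam {a} {b} {c} t≤a b+p<L m
    with m≤n⇒∃[o]m+o≡n t≤a | m≤n⇒∃[o]m+o≡n (≤-trans t≤a (≤-trans (lower m) (upper m)))
       | m≤n⇒∃[o]m+o≡n (≤-trans t≤a (lower m))
  ... | a′ , refl | b′ , refl | c′ , refl =
    argMin-≡ (swap a′) (swap b′) (swap c′)
      (argMin-shift⁺ t (border-forward border₂ b′+p<ℓ₂ (argMin-shift⁻ t m)))
    where
    swap : ∀ x → t + (p + x) ≡ p + (t + x)
    swap x = trans (sym (+-assoc t p x)) (trans (cong (_+ x) (+-comm t p)) (+-assoc p t x))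
    b′+p<ℓ₂ : b′ + p < ℓ₂
    b′+p<ℓ₂ = +-cancelˡ-< t (b′ + p) ℓ₂ (subst (_< L) (+-assoc t b′ p) b+p<L)

  forward : b + p < L → ArgMin R a b c → ArgMin R (p + a) (p + b) (p + c)
  forward {b} {a} b+p<L m with b + p <? ℓ₁ | t ≤? a
  ... | yes b+p<ℓ₁ | _ = border-forward border₁ b+p<ℓ₁ m
  ... | no _ | yes t≤a = forward-after-seam t≤a b+p<L m
  ... | no b+p≮ℓ₁ | no t≰a = forward-across-seam (≰⇒> t≰a) t≤b b+p<L m
    where
    t≤b : t ≤ b
    t≤b = +-cancelʳ-≤ p t b (≤-trans seam≤ℓ₁ (≮⇒≥ b+p≮ℓ₁))

  glued : HasBorder R L p × MinFrom R L 0
  glued = (λ b<L-p → argMin-shift⁻ p ∘ forward (<∸⇒+< b<L-p)) , minFrom-block 0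

border-glue : IsPositionOrder R → 0 < p → HasBorder R ℓ p → MinFrom R ℓ 0 →
              ∀ {ℓ′} j → HasBorder (shift (j * p) R) ℓ′ p → MinFrom (shift (j * p) R) ℓ′ 0 →
              j * p + p ≤ ℓ → R ≈[ suc p ] shift (j * p) R →
              HasBorder R (j * p + ℓ′) p × MinFrom R (j * p + ℓ′) 0
border-glue R-ord 0<p border₁ min₁ j border₂ min₂ seam≤ℓ seam =
  Glue.glued {j = j} R-ord 0<p border₁ min₁ border₂ min₂ seam≤ℓ seam

-- A Fine–Wilf-type step; the minimum at position 0 is what allows cutting intervals at p and q.
module BorderDifference {R : Rel ℕ 0ℓ} {ℓ p q : ℕ} (R-ord : IsPositionOrder R) (min : MinFrom R ℓ 0)
  (border-p : HasBorder R ℓ p) (border-q : HasBorder R ℓ q) (q<p : q < p) (p+q<ℓ : p + q < ℓ) where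

  private
    d : ℕ
    d = p ∸ q
    d+q≡p : d + q ≡ p
    d+q≡p = m∸n+n≡m (<⇒≤ q<p)
    p+≡q+d+ : ∀ x → p + x ≡ q + (d + x)
    p+≡q+d+ x = trans (cong (_+ x) (trans (sym d+q≡p) (+-comm d q))) (+-assoc q d x)

  forward-p-backward-q : b + p < ℓ → ArgMin R a b c → ArgMin R (d + a) (d + b) (d + c)
  forward-p-backward-q {b} b+p<ℓ m =
    border-backward R-ord border-q
      (subst (_< ℓ) (trans (+-comm b p) (trans (p+≡q+d+ b) (+-comm q (d + b)))) b+p<ℓ)
      (argMin-≡ (p+≡q+d+ _) (p+≡q+d+ _) (p+≡q+d+ _) (border-forward border-p b+p<ℓ m))

  backward-q-forward-p : q ≤ a → b + d < ℓ → ArgMin R a b c → ArgMin R (d + a) (d + b) (d + c)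
  backward-q-forward-p {a} {b} {c} q≤a b+d<ℓ m
    with m≤n⇒∃[o]m+o≡n q≤a | m≤n⇒∃[o]m+o≡n (≤-trans q≤a (≤-trans (lower m) (upper m)))
       | m≤n⇒∃[o]m+o≡n (≤-trans q≤a (lower m))
  ... | a′ , refl | b′ , refl | c′ , refl =
    argMin-≡ (p+≡d+q+ a′) (p+≡d+q+ b′) (p+≡d+q+ c′)
      (border-forward border-p b′+p<ℓ
        (border-backward R-ord border-q
          (≤-<-trans (≤-reflexive (+-comm b′ q)) (≤-<-trans (m≤m+n (q + b′) d) b+d<ℓ)) m))
    where
    p+≡d+q+ : ∀ x → p + x ≡ d + (q + x)
    p+≡d+q+ x = trans (cong (_+ x) (sym d+q≡p)) (+-assoc d q x)
    b′+p<ℓ : b′ + p < ℓ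
    b′+p<ℓ = subst (_< ℓ) (trans (rearrange b′ d q) (cong (b′ +_) d+q≡p)) b+d<ℓ
      where
      rearrange : ∀ b′ d q → q + b′ + d ≡ b′ + (d + q)
      rearrange = solve-∀

  forward-d : b + d < ℓ → ArgMin R a b c → ArgMin R (d + a) (d + b) (d + c)
  forward-d {b} {a} b+d<ℓ m with b + p <? ℓ | q ≤? a
  ... | yes b+p<ℓ | _ = forward-p-backward-q b+p<ℓ m
  ... | no _ | yes q≤a = backward-q-forward-p q≤a b+d<ℓ m
  ... | no b+p≮ℓ | no q≰a =
    argMin-extendʳ R-ord (subst (MinFrom R ℓ) (sym d+q≡p) (minFrom-border border-p min))
      (+-monoʳ-≤ d a≤q) (+-monoʳ-≤ d q≤b)
      (subst (_< ℓ) (+-comm b d) b+d<ℓ)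
      (forward-p-backward-q (subst (_< ℓ) (+-comm p q) p+q<ℓ)
        (argMin-shrinkʳ R-ord (minFrom-border border-q min) a≤q q≤b (≤-<-trans (m≤m+n b d) b+d<ℓ) m))
    where
    a≤q : a ≤ q
    a≤q = <⇒≤ (≰⇒> q≰a)
    q≤b : q ≤ b
    q≤b = +-cancelʳ-≤ p q b (subst (_≤ b + p) (+-comm p q) (≤-trans (<⇒≤ p+q<ℓ) (≮⇒≥ b+p≮ℓ)))

  border-difference : HasBorder R ℓ (p ∸ q)
  border-difference b<ℓ-d = argMin-shift⁻ d ∘ forward-d (<∸⇒+< b<ℓ-d)

open BorderDifference using (border-difference)

CommonDivisorBorder : Rel ℕ 0ℓ → ℕ → ℕ → ℕ → Set
CommonDivisorBorder R ℓ p q = ∃ λ g → 0 < g × g ∣ p × g ∣ q × HasBorder R ℓ g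

border-common-divisor : IsPositionOrder R → MinFrom R ℓ 0 → HasBorder R ℓ p → HasBorder R ℓ q →
                        0 < p → 0 < q → p + q < ℓ → CommonDivisorBorder R ℓ p q
border-common-divisor {R = R} {ℓ = ℓ} {p = p} {q = q} R-ord min = euclid (p + q) ≤-refl
  where
  euclid : ∀ fuel {p q} → p + q ≤ fuel → HasBorder R ℓ p → HasBorder R ℓ q →
           0 < p → 0 < q → p + q < ℓ → CommonDivisorBorder R ℓ p q
  subtract : ∀ fuel {p q} → q < p → p + q ≤ suc fuel → HasBorder R ℓ p → HasBorder R ℓ q →
             0 < q → p + q < ℓ → CommonDivisorBorder R ℓ p q

  euclid zero {zero} _ _ _ () _ _
  euclid zero {suc _} () _ _ _ _ _
  euclid (suc fuel) {p} {q} p+q≤ border-p border-q 0<p 0<q p+q<ℓ with <-cmp p q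
  ... | tri≈ _ refl _ = p , 0<p , ∣-refl , ∣-refl , border-p
  ... | tri> _ _ q<p = subtract fuel q<p p+q≤ border-p border-q 0<q p+q<ℓ
  ... | tri< p<q _ _
    with subtract fuel p<q (subst (_≤ suc fuel) (+-comm p q) p+q≤) border-q border-p 0<p
           (subst (_< ℓ) (+-comm p q) p+q<ℓ)
  ...   | g , 0<g , g∣q , g∣p , border-g = g , 0<g , g∣p , g∣q , border-g

  subtract fuel {p} {q} q<p p+q≤ border-p border-q 0<q p+q<ℓ
    with euclid fuel
           (subst (_≤ fuel) (sym p-q+q≡p)
             (s≤s⁻¹ (≤-trans (≤-reflexive (+-comm 1 p)) (≤-trans (+-monoʳ-≤ p 0<q) p+q≤))))
           (border-difference R-ord min border-p border-q q<p p+q<ℓ) border-q (m<n⇒0<n∸m q<p) 0<q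
           (subst (_< ℓ) (sym p-q+q≡p) (≤-<-trans (m≤m+n p q) p+q<ℓ))
    where
    p-q+q≡p : p ∸ q + q ≡ p
    p-q+q≡p = m∸n+n≡m (<⇒≤ q<p)
  ... | g , 0<g , g∣p-q , g∣q , border-g = g , 0<g , ∣m∸n∣n⇒∣m g (<⇒≤ q<p) g∣p-q g∣q , g∣q , border-g

-- Mirror images

-- Positions beyond N are put above all others, in increasing order, only to keep the order
-- total. The mirror of a rank order breaks ties to the right, so it is not the rank order of
-- the reversed string.
mirror : ℕ → Rel ℕ 0ℓ → Rel ℕ 0ℓ
mirror N R x y = (x ≤ N × y ≤ N × R (N ∸ x) (N ∸ y)) ⊎ (x ≤ N × N < y) ⊎ (N < x × N < y × x < y)

mirror-order : ∀ N → IsPositionOrder R → IsPositionOrder (mirror N R)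
mirror-order {R = R} N R-ord = record { irreflexive = irr ; transitive = trans′ ; connected = conn }
  where
  irr : ∀ x → ¬ mirror N R x x
  irr x (inj₁ (_ , _ , r)) = irreflexive R-ord (N ∸ x) r
  irr x (inj₂ (inj₁ (x≤N , N<x))) = <⇒≱ N<x x≤N
  irr x (inj₂ (inj₂ (_ , _ , x<x))) = <-irrefl refl x<x
  trans′ : ∀ {x y z} → mirror N R x y → mirror N R y z → mirror N R x z
  trans′ (inj₁ (x≤N , _ , r)) (inj₁ (_ , z≤N , r′)) = inj₁ (x≤N , z≤N , transitive R-ord r r′)
  trans′ (inj₁ (x≤N , _ , _)) (inj₂ (inj₁ (_ , N<z))) = inj₂ (inj₁ (x≤N , N<z))
  trans′ (inj₁ (_ , y≤N , _)) (inj₂ (inj₂ (N<y , _ , _))) = ⊥-elim (<⇒≱ N<y y≤N)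
  trans′ (inj₂ (inj₁ (_ , N<y))) (inj₁ (y≤N , _ , _)) = ⊥-elim (<⇒≱ N<y y≤N)
  trans′ (inj₂ (inj₁ (_ , N<y))) (inj₂ (inj₁ (y≤N , _))) = ⊥-elim (<⇒≱ N<y y≤N)
  trans′ (inj₂ (inj₁ (x≤N , _))) (inj₂ (inj₂ (_ , N<z , _))) = inj₂ (inj₁ (x≤N , N<z))
  trans′ (inj₂ (inj₂ (_ , N<y , _))) (inj₁ (y≤N , _ , _)) = ⊥-elim (<⇒≱ N<y y≤N)
  trans′ (inj₂ (inj₂ (_ , N<y , _))) (inj₂ (inj₁ (y≤N , _))) = ⊥-elim (<⇒≱ N<y y≤N)
  trans′ (inj₂ (inj₂ (N<x , _ , x<y))) (inj₂ (inj₂ (_ , N<z , y<z))) =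
    inj₂ (inj₂ (N<x , N<z , <-trans x<y y<z))
  conn : ∀ x y → x ≢ y → mirror N R x y ⊎ mirror N R y x
  conn x y x≢y with x ≤? N | y ≤? N
  ... | yes x≤N | yes y≤N with connected R-ord (N ∸ x) (N ∸ y) (x≢y ∘ ∸-cancelˡ-≡ x≤N y≤N)
  ...   | inj₁ r = inj₁ (inj₁ (x≤N , y≤N , r))
  ...   | inj₂ r = inj₂ (inj₁ (y≤N , x≤N , r))
  conn x y x≢y | yes x≤N | no y≰N = inj₁ (inj₂ (inj₁ (x≤N , ≰⇒> y≰N)))
  conn x y x≢y | no x≰N | yes y≤N = inj₂ (inj₂ (inj₁ (y≤N , ≰⇒> x≰N)))
  conn x y x≢y | no x≰N | no y≰N with <-cmp x y
  ... | tri< x<y _ _ = inj₁ (inj₂ (inj₂ (≰⇒> x≰N , ≰⇒> y≰N , x<y)))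
  ... | tri≈ _ x≡y _ = ⊥-elim (x≢y x≡y)
  ... | tri> _ _ y<x = inj₂ (inj₂ (inj₂ (≰⇒> y≰N , ≰⇒> x≰N , y<x)))

private
  complement-anti : ∀ {x x′ y y′ N} → x + x′ ≡ N → y + y′ ≡ N → x ≤ y → y′ ≤ x′
  complement-anti {x} {x′} {y} {y′} x+x′≡N y+y′≡N x≤y =
    +-cancelˡ-≤ x y′ x′ (≤-trans (+-monoˡ-≤ y′ x≤y) (≤-reflexive (trans y+y′≡N (sym x+x′≡N))))

  complement-unique : ∀ {x y y′ N} → x + y ≡ N → x + y′ ≡ N → y ≡ y′
  complement-unique {x} x+y≡N x+y′≡N = +-cancelˡ-≡ x _ _ (trans x+y≡N (sym x+y′≡N))

  complement : ∀ {x N} → x ≤ N → x + (N ∸ x) ≡ N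
  complement = m+[n∸m]≡n

argMin-mirror : ∀ {N} → a + b′ ≡ N → b + a′ ≡ N → c + c′ ≡ N →
                ArgMin R a b c → ArgMin (mirror N R) a′ b′ c′
argMin-mirror {a = a} {b′ = b′} {b = b} {a′ = a′} {c = c} {c′ = c′} {R = R} {N = N}
              a+b′≡N b+a′≡N c+c′≡N m =
  argMin (complement-anti c+c′≡N b+a′≡N (upper m)) (complement-anti a+b′≡N c+c′≡N (lower m)) least′
  where
  least′ : ∀ k → a′ ≤ k → k ≤ b′ → k ≢ c′ → mirror N R c′ k
  least′ k a′≤k k≤b′ k≢c′ =
    inj₁ (c′≤N , k≤N ,
          subst (λ x → R x (N ∸ k)) (complement-unique (trans (+-comm c′ c) c+c′≡N) (complement c′≤N))
            (least m (N ∸ k) a≤k* k*≤b k*≢c))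
    where
    c′≤N : c′ ≤ N
    c′≤N = subst (c′ ≤_) c+c′≡N (m≤n+m c′ c)
    k≤N : k ≤ N
    k≤N = ≤-trans k≤b′ (subst (b′ ≤_) a+b′≡N (m≤n+m b′ a))
    k+k*≡N : k + (N ∸ k) ≡ N
    k+k*≡N = complement k≤N
    a≤k* : a ≤ N ∸ k
    a≤k* = complement-anti k+k*≡N (trans (+-comm b′ a) a+b′≡N) k≤b′
    k*≤b : N ∸ k ≤ b
    k*≤b = complement-anti (trans (+-comm a′ b) b+a′≡N) k+k*≡N a′≤k
    k*≢c : N ∸ k ≢ c
    k*≢c k*≡c = k≢c′ (+-cancelʳ-≡ c k c′ (trans (trans (cong (k +_) (sym k*≡c)) k+k*≡N)
                                              (trans (sym c+c′≡N) (+-comm c c′))))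

argMin-mirror⁻ : ∀ {N} → a + b′ ≡ N → b + a′ ≡ N → c + c′ ≡ N →
                 ArgMin (mirror N R) a′ b′ c′ → ArgMin R a b c
argMin-mirror⁻ {a = a} {b′ = b′} {b = b} {a′ = a′} {c = c} {c′ = c′} {R = R} {N = N}
               a+b′≡N b+a′≡N c+c′≡N m =
  argMin (complement-anti c′+c≡N b′+a≡N (upper m)) (complement-anti a′+b≡N c′+c≡N (lower m)) least′
  where
  c′+c≡N : c′ + c ≡ N
  c′+c≡N = trans (+-comm c′ c) c+c′≡N
  b′+a≡N : b′ + a ≡ N
  b′+a≡N = trans (+-comm b′ a) a+b′≡N
  a′+b≡N : a′ + b ≡ N
  a′+b≡N = trans (+-comm a′ b) b+a′≡N
  least′ : ∀ k → a ≤ k → k ≤ b → k ≢ c → R c k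
  least′ k a≤k k≤b k≢c = from-mirror (least m (N ∸ k) a′≤k* k*≤b′ k*≢c′)
    where
    k≤N : k ≤ N
    k≤N = ≤-trans k≤b (subst (b ≤_) b+a′≡N (m≤m+n b a′))
    k+k*≡N : k + (N ∸ k) ≡ N
    k+k*≡N = complement k≤N
    a′≤k* : a′ ≤ N ∸ k
    a′≤k* = complement-anti k+k*≡N b+a′≡N k≤b
    k*≤b′ : N ∸ k ≤ b′
    k*≤b′ = complement-anti a+b′≡N k+k*≡N a≤k
    k*≢c′ : N ∸ k ≢ c′
    k*≢c′ k*≡c′ = k≢c (+-cancelʳ-≡ c′ k c (trans (trans (cong (k +_) (sym k*≡c′)) k+k*≡N) (sym c+c′≡N)))
    from-mirror : mirror N R c′ (N ∸ k) → R c k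
    from-mirror (inj₁ (c′≤N , _ , r)) =
      subst₂ R (complement-unique (complement c′≤N) c′+c≡N) (m∸[m∸n]≡n k≤N) r
    from-mirror (inj₂ (inj₁ (_ , N<k*))) = ⊥-elim (<⇒≱ N<k* (m∸n≤m N k))
    from-mirror (inj₂ (inj₂ (N<c′ , _))) = ⊥-elim (<⇒≱ N<c′ (subst (c′ ≤_) c+c′≡N (m≤n+m c′ c)))

Mirrored : ℕ → Rel ℕ 0ℓ → Rel ℕ 0ℓ → Set
Mirrored L S S′ = ∀ {a b c a′ b′ c′} → suc (a + b′) ≡ L → suc (b + a′) ≡ L → suc (c + c′) ≡ L →
                  ArgMin S a b c → ArgMin S′ a′ b′ c′

Mirrors : ℕ → Rel ℕ 0ℓ → Rel ℕ 0ℓ → Set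
Mirrors N X Y = ∀ s L s′ → s + L + s′ ≡ suc N → Mirrored L (shift s X) (shift s′ Y)

private
  window-complement : ∀ s s′ x y {L N} → s + L + s′ ≡ suc N → suc (x + y) ≡ L → (s + x) + (s′ + y) ≡ N
  window-complement s s′ x y s+L+s′≡N+1 refl = suc-injective (trans (rearrange s x s′ y) s+L+s′≡N+1)
    where
    rearrange : ∀ s x s′ y → suc ((s + x) + (s′ + y)) ≡ s + suc (x + y) + s′
    rearrange = solve-∀

mirrors : ∀ N R → Mirrors N R (mirror N R)
mirrors N R s L s′ e {a} {b} {c} {a′} {b′} {c′} a+b′ b+a′ c+c′ =
  argMin-shift⁻ {R = mirror N R} s′ ∘
  argMin-mirror (window-complement s s′ a b′ e a+b′) (window-complement s s′ b a′ e b+a′)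
                (window-complement s s′ c c′ e c+c′) ∘
  argMin-shift⁺ {R = R} s

mirrors⁻ : ∀ N R → Mirrors N (mirror N R) R
mirrors⁻ N R s L s′ e {a} {b} {c} {a′} {b′} {c′} a+b′ b+a′ c+c′ =
  argMin-shift⁻ {R = R} s′ ∘
  argMin-mirror⁻ (flip-window a′ b b+a′) (flip-window b′ a a+b′) (flip-window c′ c c+c′) ∘
  argMin-shift⁺ {R = mirror N R} s
  where
  flip-window : ∀ x y → suc (y + x) ≡ L → (s′ + x) + (s + y) ≡ N
  flip-window x y y+x≡L = trans (+-comm (s′ + x) (s + y)) (window-complement s s′ y x e y+x≡L)

mirror-≈ : ∀ {L S′ U′} → Mirrored L S′ S → Mirrored L U U′ → S ≈[ L ] U → S′ ≈[ L ] U′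
mirror-≈ {S = S} {U = U} {L = L} {S′} {U′} S′→S U→U′ S≈U {a′} {b′} {c′} b′<L m =
  U→U′ (flipped b′<L) (flipped a′<L) (flipped c′<L)
    (S≈U (subst (L ∸ suc a′ <_) (flipped′ a′<L) (s≤s (m≤n+m _ a′)))
      (S′→S (flipped′ a′<L) (flipped′ b′<L) (flipped′ c′<L) m))
  where
  c′<L : c′ < L
  c′<L = ≤-<-trans (upper m) b′<L
  a′<L : a′ < L
  a′<L = ≤-<-trans (lower m) c′<L
  flipped′ : ∀ {x} → x < L → suc (x + (L ∸ suc x)) ≡ L
  flipped′ = m+[n∸m]≡n
  flipped : ∀ {x} → x < L → suc ((L ∸ suc x) + x) ≡ L
  flipped {x} x<L = trans (cong suc (+-comm (L ∸ suc x) x)) (flipped′ x<L)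

mirror-border : ∀ {X Y N s L s′} → IsPositionOrder Y → Mirrors N X Y → Mirrors N Y X →
                s + L + s′ ≡ suc N → p ≤ L → HasBorder (shift s X) L p → HasBorder (shift s′ Y) L p
mirror-border {p = p} {X = X} {Y} {N} {s} {L} {s′} Y-ord X→Y Y→X window p≤L border =
  ≈-shift-shift⁺ {S = Y} p s′
    (≈-sym (shift-order (s′ + p) Y-ord) (shift-order s′ Y-ord)
      (mirror-≈ (Y→X (s′ + p) L′ s e₁) (X→Y (s + p) L′ s′ e₂) (≈-shift-shift⁻ {S = X} p s border)))
  where
  L′ : ℕ
  L′ = L ∸ p
  L′+p≡L : L′ + p ≡ L
  L′+p≡L = m∸n+n≡m p≤L
  e₁ : s′ + p + L′ + s ≡ suc N
  e₁ = trans (rearrange s′ p L′ s) (trans (cong (λ l → s + l + s′) L′+p≡L) window)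
    where
    rearrange : ∀ s′ p L′ s → s′ + p + L′ + s ≡ s + (L′ + p) + s′
    rearrange = solve-∀
  e₂ : s + p + L′ + s′ ≡ suc N
  e₂ = trans (rearrange s p L′ s′) (trans (cong (λ l → s + l + s′) L′+p≡L) window)
    where
    rearrange : ∀ s p L′ s′ → s + p + L′ + s′ ≡ s + (L′ + p) + s′
    rearrange = solve-∀

mirror-start⇒end : ∀ {L S′} → Mirrored L S S′ → 0 < L →
                   ArgMin S 0 (L ∸ 1) 0 → ArgMin S′ 0 (L ∸ 1) (L ∸ 1)
mirror-start⇒end {L = zero} _ ()
mirror-start⇒end {L = suc L} S→S′ _ = S→S′ refl (cong suc (+-identityʳ L)) refl

mirror-end⇒start : ∀ {L S′} → Mirrored L S S′ → 0 < L →
                   ArgMin S 0 (L ∸ 1) (L ∸ 1) → ArgMin S′ 0 (L ∸ 1) 0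
mirror-end⇒start {L = zero} _ ()
mirror-end⇒start {L = suc L} S→S′ _ = S→S′ refl (cong suc (+-identityʳ L)) (cong suc (+-identityʳ L))

-- Occurrences of a pattern with a small block period

MinAtBoundary : Rel ℕ 0ℓ → ℕ → Set
MinAtBoundary R ℓ = ArgMin R 0 (ℓ ∸ 1) 0 ⊎ ArgMin R 0 (ℓ ∸ 1) (ℓ ∸ 1)

record IsBlockPeriod (R : Rel ℕ 0ℓ) (ℓ g : ℕ) : Set where
  field
    divides-length  : g ∣ ℓ
    positive        : 0 < g
    at-most-length  : g ≤ ℓ
    has-border      : HasBorder R ℓ g
    min-at-boundary : MinAtBoundary R ℓ

argMin⇒minFrom : 0 < ℓ → ArgMin R 0 (ℓ ∸ 1) 0 → MinFrom R ℓ 0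
argMin⇒minFrom {zero} () _
argMin⇒minFrom {suc ℓ} _ m k 0<k k<ℓ = least m k z≤n (s≤s⁻¹ k<ℓ) (>⇒≢ 0<k)

minFrom⇒argMin-start : 0 < ℓ → MinFrom R ℓ 0 → ArgMin R 0 (ℓ ∸ 1) 0
minFrom⇒argMin-start 0<ℓ min = minFrom⇒argMin min z≤n (∸-monoʳ-< z<s 0<ℓ)

boundary-≈ : 0 < ℓ → R ≈[ ℓ ] S → MinAtBoundary R ℓ → MinAtBoundary S ℓ
boundary-≈ 0<ℓ R≈S (inj₁ start) = inj₁ (R≈S (∸-monoʳ-< z<s 0<ℓ) start)
boundary-≈ 0<ℓ R≈S (inj₂ end) = inj₂ (R≈S (∸-monoʳ-< z<s 0<ℓ) end)

blockPeriod-≈ : ∀ {g} → IsPositionOrder R → IsPositionOrder S → R ≈[ ℓ ] S →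
                IsBlockPeriod R ℓ g → IsBlockPeriod S ℓ g
blockPeriod-≈ R-ord S-ord R≈S block = record
  { divides-length = divides-length ; positive = positive ; at-most-length = at-most-length
  ; has-border = border-≈ R-ord S-ord R≈S has-border
  ; min-at-boundary = boundary-≈ (<-≤-trans positive at-most-length) R≈S min-at-boundary }
  where open IsBlockPeriod block

-- The minimum of P is at its first position; `periodic-occurrences` reduces the other case to
-- this one by mirroring P and T.
module PeriodicPattern {RP RT : Rel ℕ 0ℓ} {m p : ℕ}
  (P-ord : IsPositionOrder RP) (T-ord : IsPositionOrder RT)
  (0<p : 0 < p) (p∣m : p ∣ m) (p+p≤m : p + p ≤ m) (borderP : HasBorder RP m p) (minP : MinFrom RP m 0)
  (minimal : ∀ g → IsBlockPeriod RP m g → p ≤ g) where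

  Occurs : ℕ → Set
  Occurs u = RP ≈[ m ] shift u RT

  private
    p<m : p < m
    p<m = <-≤-trans (subst (_< p + p) (+-identityʳ p) (+-monoʳ-< p 0<p)) p+p≤m

    window-order : ∀ u → IsPositionOrder (shift u RT)
    window-order u = shift-order u T-ord

    window-border : Occurs u → HasBorder (shift u RT) m p
    window-border {u} occ = border-≈ P-ord (window-order u) occ borderP

    window-min : Occurs u → MinFrom (shift u RT) m 0
    window-min occ = minFrom-≈ occ minP

    first-occurrence : ∀ {u z} → (∀ v → v ≤ z → Occurs (u + v * p)) → Occurs u
    first-occurrence {u} occs = subst Occurs (+-identityʳ u) (occs 0 z≤n)

    dividing-border-is-p : ∀ {g} → 0 < g → g ∣ p → HasBorder RP m g → g ≡ p
    dividing-border-is-p {g} 0<g g∣p border =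
      ≤-antisym (∣⇒≤ ⦃ >-nonZero 0<p ⦄ g∣p)
        (minimal g record
          { divides-length = ∣-trans g∣p p∣m ; positive = 0<g
          ; at-most-length = ≤-trans (∣⇒≤ ⦃ >-nonZero 0<p ⦄ g∣p) (<⇒≤ p<m)
          ; has-border = border ; min-at-boundary = inj₁ (minFrom⇒argMin-start (<-trans 0<p p<m) minP) })

  progression-border : ∀ u z → (∀ v → v ≤ z → Occurs (u + v * p)) →
                       HasBorder (shift u RT) (z * p + m) p × MinFrom (shift u RT) (z * p + m) 0
  progression-border u zero occs =
    window-border (first-occurrence occs) , window-min (first-occurrence occs)
  progression-border u (suc z) occs =
    border-glue (window-order u) 0<p border min (suc z)
      (border-≈ P-ord (shift-order (suc z * p) (window-order u)) last borderP) (minFrom-≈ last minP)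
      seam≤
      (≈-weaken p<m (≈-trans (≈-sym P-ord (window-order u) (first-occurrence occs)) last))
    where
    previous : HasBorder (shift u RT) (z * p + m) p × MinFrom (shift u RT) (z * p + m) 0
    previous = progression-border u z (λ v v≤z → occs v (m≤n⇒m≤1+n v≤z))
    border : HasBorder (shift u RT) (z * p + m) p
    border = proj₁ previous
    min : MinFrom (shift u RT) (z * p + m) 0
    min = proj₂ previous
    last : RP ≈[ m ] shift (suc z * p) (shift u RT)
    last = ≈-shift-shift⁺ {S = RT} (suc z * p) u (occs (suc z) ≤-refl)
    seam≤ : suc z * p + p ≤ z * p + m
    seam≤ = subst (_≤ z * p + m) (rearrange z p) (+-monoʳ-≤ (z * p) p+p≤m)
      where
      rearrange : ∀ z p → z * p + (p + p) ≡ suc z * p + p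
      rearrange = solve-∀

  progression-no-shorter-border : ∀ u z → (∀ v → v ≤ z → Occurs (u + v * p)) →
                                  0 < q → q < p → ¬ HasBorder (shift u RT) (z * p + m) q
  progression-no-shorter-border {q = q} u z occs 0<q q<p border-q
    with progression-border u z occs
  ... | border-p , min
    with border-common-divisor (window-order u) min border-p border-q 0<p 0<q
           (<-≤-trans (+-monoʳ-< p q<p) (≤-trans p+p≤m (m≤n+m m (z * p))))
  ... | g , 0<g , g∣p , g∣q , border-g = <⇒≱ q<p (begin
    p ≡⟨ sym (dividing-border-is-p 0<g g∣p border-on-P) ⟩
    g ≤⟨ ∣⇒≤ ⦃ >-nonZero 0<q ⦄ g∣q ⟩
    q ∎)
    where
    open ≤-Reasoning
    border-on-P : HasBorder RP m g
    border-on-P = border-≈ (window-order u) P-ord (≈-sym P-ord (window-order u) (first-occurrence occs))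
                    (≈-weaken (∸-monoˡ-≤ g (m≤n+m m (z * p))) border-g)

  module _ {x d : ℕ} (at-x : Occurs x) (at-x+d : Occurs (x + d)) (0<d : 0 < d) (d+p≤m : d + p ≤ m) where

    private
      at-x+d′ : RP ≈[ m ] shift d (shift x RT)
      at-x+d′ = ≈-shift-shift⁺ {S = RT} d x at-x+d

      border-d : HasBorder RP m d
      border-d = ≈-trans (≈-weaken (m∸n≤m m d) at-x+d′) (≈-shift d (≈-sym P-ord (window-order x) at-x))

      p∣d : p ∣ d
      p∣d with m≤n⇒m<n∨m≡n d+p≤m
      ... | inj₂ d+p≡m = ∣m+n∣m⇒∣n (subst (p ∣_) (trans (sym d+p≡m) (+-comm d p)) p∣m) ∣-refl
      ... | inj₁ d+p<m
        with border-common-divisor P-ord minP borderP border-d 0<p 0<d (subst (_< m) (+-comm d p) d+p<m)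
      ...   | g , 0<g , g∣p , g∣d , border-g with dividing-border-is-p 0<g g∣p border-g
      ...     | refl = g∣d

      glued : HasBorder (shift x RT) (d + m) p × MinFrom (shift x RT) (d + m) 0
      glued with p∣d
      ... | divides w d≡wp =
        subst (λ l → HasBorder (shift x RT) (l + m) p × MinFrom (shift x RT) (l + m) 0) (sym d≡wp)
        (border-glue (window-order x) 0<p (window-border at-x) (window-min at-x) w
          (border-≈ P-ord (shift-order (w * p) (window-order x)) at-x+d″ borderP)
          (minFrom-≈ at-x+d″ minP)
          (subst (λ l → l + p ≤ m) d≡wp d+p≤m)
          (≈-weaken p<m (≈-trans (≈-sym P-ord (window-order x) at-x) at-x+d″)))
        where
        at-x+d″ : RP ≈[ m ] shift (w * p) (shift x RT)
        at-x+d″ = subst (λ l → RP ≈[ m ] shift l (shift x RT)) d≡wp at-x+d′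

    p≤d : p ≤ d
    p≤d = ∣⇒≤ ⦃ >-nonZero 0<d ⦄ p∣d

    occurrence-after : Occurs (x + p)
    occurrence-after = ≈-shift-shift⁻ {S = RT} p x
      (border-transport⁺ {w = 0} (proj₁ glued) (+-monoˡ-≤ m p≤d) at-x)

    occurrence-before : ∀ y → y + p ≡ x + d → Occurs y
    occurrence-before y y+p≡x+d = subst Occurs (sym y≡x+[d-p]) (≈-shift-shift⁻ {S = RT} (d ∸ p) x
      (border-transport⁻ (window-order x) (proj₁ glued) (≤-reflexive (cong (_+ m) [d-p]+p≡d))
        (subst (λ l → RP ≈[ m ] shift l (shift x RT)) (sym [d-p]+p≡d) at-x+d′)))
      where
      [d-p]+p≡d : d ∸ p + p ≡ d
      [d-p]+p≡d = m∸n+n≡m p≤d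
      y≡x+[d-p] : y ≡ x + (d ∸ p)
      y≡x+[d-p] = +-cancelʳ-≡ p y (x + (d ∸ p))
                    (trans y+p≡x+d (trans (cong (x +_) (sym [d-p]+p≡d)) (sym (+-assoc x (d ∸ p) p))))

OccursWithin : Rel ℕ 0ℓ → Rel ℕ 0ℓ → ℕ → ℕ → ℕ → Set
OccursWithin RP RT m n u = u + m ≤ n × RP ≈[ m ] shift u RT

record PeriodicOccurrences (RP RT : Rel ℕ 0ℓ) (m p n : ℕ) : Set where
  field
    progression-border :
      ∀ u z → (∀ v → v ≤ z → OccursWithin RP RT m n (u + v * p)) →
      HasBorder (shift u RT) (z * p + m) p × MinAtBoundary (shift u RT) (z * p + m)
    progression-no-shorter-border :
      ∀ u z q → (∀ v → v ≤ z → OccursWithin RP RT m n (u + v * p)) →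
      0 < q → q < p → ¬ HasBorder (shift u RT) (z * p + m) q
    occurrence-before :
      ∀ x d → OccursWithin RP RT m n x → OccursWithin RP RT m n (x + d) → 0 < d → d + p ≤ m →
      ∃ λ y → y + p ≡ x + d × OccursWithin RP RT m n y

module _ {RP RT : Rel ℕ 0ℓ} {m p : ℕ} (P-ord : IsPositionOrder RP) (T-ord : IsPositionOrder RT)
  (0<p : 0 < p) (p∣m : p ∣ m) (p+p≤m : p + p ≤ m) (borderP : HasBorder RP m p)
  (minimal : ∀ g → IsBlockPeriod RP m g → p ≤ g) where

  private
    0<m : 0 < m
    0<m = <-≤-trans 0<p (≤-trans (m≤m+n p p) p+p≤m)

  periodic-occurrences-min-at-start : ArgMin RP 0 (m ∸ 1) 0 → PeriodicOccurrences RP RT m p n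
  periodic-occurrences-min-at-start start = record
    { progression-border = λ u z occs →
        let border , min = progression-border u z (λ v v≤z → proj₂ (occs v v≤z))
        in border , inj₁ (minFrom⇒argMin-start (<-≤-trans 0<m (m≤n+m m (z * p))) min)
    ; progression-no-shorter-border = λ u z q occs →
        progression-no-shorter-border u z (λ v v≤z → proj₂ (occs v v≤z))
    ; occurrence-before = λ x d (x+m≤n , at-x) (x+d+m≤n , at-x+d) 0<d d+p≤m →
        let y = x + d ∸ p
            y+p≡x+d : y + p ≡ x + d
            y+p≡x+d = m∸n+n≡m (≤-trans (p≤d at-x at-x+d 0<d d+p≤m) (m≤n+m d x))
        in y , y+p≡x+d ,
           (≤-trans (+-monoˡ-≤ m (subst (y ≤_) y+p≡x+d (m≤m+n y p))) x+d+m≤n) ,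
           occurrence-before at-x at-x+d 0<d d+p≤m y y+p≡x+d
    }
    where
    open PeriodicPattern P-ord T-ord 0<p p∣m p+p≤m borderP (argMin⇒minFrom 0<m start) minimal

  module MirroredCase (N : ℕ) (end : ArgMin RP 0 (m ∸ 1) (m ∸ 1)) where
    private
      M : ℕ
      M = m ∸ 1
      P′ : Rel ℕ 0ℓ
      P′ = mirror M RP
      T′ : Rel ℕ 0ℓ
      T′ = mirror N RT
      P′-ord : IsPositionOrder P′
      P′-ord = mirror-order M P-ord
      T′-ord : IsPositionOrder T′
      T′-ord = mirror-order N T-ord

      whole : 0 + m + 0 ≡ suc M
      whole = trans (+-identityʳ m) (sym (m+[n∸m]≡n 0<m))

      swap : ∀ a b c → a + b + c ≡ c + b + a
      swap = solve-∀

      borderP′ : HasBorder P′ m p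
      borderP′ = mirror-border P′-ord (mirrors M RP) (mirrors⁻ M RP) whole
                   (≤-trans (m≤m+n p p) p+p≤m) borderP

      startP′ : ArgMin P′ 0 (m ∸ 1) 0
      startP′ = mirror-end⇒start (mirrors M RP 0 m 0 whole) 0<m end

      minimal′ : ∀ g → IsBlockPeriod P′ m g → p ≤ g
      minimal′ g block = minimal g record
        { divides-length = divides-length ; positive = positive ; at-most-length = at-most-length
        ; has-border = mirror-border P-ord (mirrors⁻ M RP) (mirrors M RP) whole at-most-length has-border
        ; min-at-boundary = swap-ends min-at-boundary }
        where
        open IsBlockPeriod block
        swap-ends : MinAtBoundary P′ m → MinAtBoundary RP m
        swap-ends (inj₁ start) = inj₂ (mirror-start⇒end (mirrors⁻ M RP 0 m 0 whole) 0<m start)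
        swap-ends (inj₂ end′) = inj₁ (mirror-end⇒start (mirrors⁻ M RP 0 m 0 whole) 0<m end′)

      to-mirror : ∀ u u′ → u + m + u′ ≡ suc N → RP ≈[ m ] shift u RT → P′ ≈[ m ] shift u′ T′
      to-mirror u u′ e = mirror-≈ (mirrors⁻ M RP 0 m 0 whole) (mirrors N RT u m u′ e)

      from-mirror : ∀ u u′ → u + m + u′ ≡ suc N → P′ ≈[ m ] shift u′ T′ → RP ≈[ m ] shift u RT
      from-mirror u u′ e =
        mirror-≈ (mirrors M RP 0 m 0 whole) (mirrors⁻ N RT u′ m u (trans (swap u′ m u) e))

      open PeriodicPattern P′-ord T′-ord 0<p p∣m p+p≤m borderP′ (argMin⇒minFrom 0<m startP′) minimal′

    mirrored-progression : ∀ u z → (∀ v → v ≤ z → OccursWithin RP RT m (suc N) (u + v * p)) →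
                           ∃ λ u′ → u + (z * p + m) + u′ ≡ suc N × (∀ v → v ≤ z → Occurs (u′ + v * p))
    mirrored-progression u z occs = u′ , e , occs′
      where
      fits : u + (z * p + m) ≤ suc N
      fits = subst (_≤ suc N) (+-assoc u (z * p) m) (proj₁ (occs z ≤-refl))
      u′ : ℕ
      u′ = suc N ∸ (u + (z * p + m))
      e : u + (z * p + m) + u′ ≡ suc N
      e = m+[n∸m]≡n fits
      occs′ : ∀ v → v ≤ z → Occurs (u′ + v * p)
      occs′ v v≤z = to-mirror (u + (z ∸ v) * p) (u′ + v * p) e′ (proj₂ (occs (z ∸ v) (m∸n≤m z v)))
        where
        rearrange : ∀ u w v p m u′ → u + w * p + m + (u′ + v * p) ≡ u + ((w + v) * p + m) + u′
        rearrange = solve-∀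
        e′ : u + (z ∸ v) * p + m + (u′ + v * p) ≡ suc N
        e′ = trans (rearrange u (z ∸ v) v p m u′)
               (trans (cong (λ w → u + (w * p + m) + u′) (m∸n+n≡m v≤z)) e)

    private
      p≤m : p ≤ m
      p≤m = ≤-trans (m≤m+n p p) p+p≤m

    mirrored-progression-border :
      ∀ u z → (∀ v → v ≤ z → OccursWithin RP RT m (suc N) (u + v * p)) →
      HasBorder (shift u RT) (z * p + m) p × MinAtBoundary (shift u RT) (z * p + m)
    mirrored-progression-border u z occs with mirrored-progression u z occs
    ... | u′ , e , occs′ =
      mirror-border {X = T′} {s = u′} {s′ = u} T-ord (mirrors⁻ N RT) (mirrors N RT) e′
        (≤-trans p≤m m≤L) border ,
      inj₂ (mirror-start⇒end (mirrors⁻ N RT u′ L u e′) 0<L (minFrom⇒argMin-start 0<L min))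
      where
      L : ℕ
      L = z * p + m
      m≤L : m ≤ L
      m≤L = m≤n+m m (z * p)
      0<L : 0 < L
      0<L = <-≤-trans 0<m m≤L
      e′ : u′ + L + u ≡ suc N
      e′ = trans (swap u′ L u) e
      border : HasBorder (shift u′ T′) L p
      border = proj₁ (progression-border u′ z occs′)
      min : MinFrom (shift u′ T′) L 0
      min = proj₂ (progression-border u′ z occs′)

    mirrored-no-shorter-border :
      ∀ u z q → (∀ v → v ≤ z → OccursWithin RP RT m (suc N) (u + v * p)) →
      0 < q → q < p → ¬ HasBorder (shift u RT) (z * p + m) q
    mirrored-no-shorter-border u z q occs 0<q q<p border-q with mirrored-progression u z occs
    ... | u′ , e , occs′ =
      progression-no-shorter-border u′ z occs′ 0<q q<p
        (mirror-border {X = RT} {s = u} {s′ = u′} T′-ord (mirrors N RT) (mirrors⁻ N RT) e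
          (≤-trans (<⇒≤ q<p) (≤-trans p≤m (m≤n+m m (z * p)))) border-q)

    mirrored-occurrence-before :
      ∀ x d → OccursWithin RP RT m (suc N) x → OccursWithin RP RT m (suc N) (x + d) → 0 < d → d + p ≤ m →
      ∃ λ y → y + p ≡ x + d × OccursWithin RP RT m (suc N) y
    mirrored-occurrence-before x d (_ , at-x) (x+d+m≤n , at-x+d) 0<d d+p≤m =
      y , y+p≡x+d , subst (y + m ≤_) e-y (m≤m+n (y + m) (x′ + p)) ,
      from-mirror y (x′ + p) e-y (occurrence-after at-x+d′ at-x′ 0<d d+p≤m)
      where
      x′ : ℕ
      x′ = suc N ∸ (x + d + m)
      e : x + d + m + x′ ≡ suc N
      e = m+[n∸m]≡n x+d+m≤n
      rearrange : ∀ x d m x′ → x + m + (x′ + d) ≡ x + d + m + x′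
      rearrange = solve-∀
      at-x′ : P′ ≈[ m ] shift (x′ + d) T′
      at-x′ = to-mirror x (x′ + d) (trans (rearrange x d m x′) e) at-x
      at-x+d′ : P′ ≈[ m ] shift x′ T′
      at-x+d′ = to-mirror (x + d) x′ e at-x+d
      y : ℕ
      y = x + d ∸ p
      y+p≡x+d : y + p ≡ x + d
      y+p≡x+d = m∸n+n≡m (≤-trans (p≤d at-x+d′ at-x′ 0<d d+p≤m) (m≤n+m d x))
      e-y : y + m + (x′ + p) ≡ suc N
      e-y = trans (rearrange y p m x′) (trans (cong (λ l → l + m + x′) y+p≡x+d) e)

    periodic-occurrences-min-at-end : PeriodicOccurrences RP RT m p (suc N)
    periodic-occurrences-min-at-end = record
      { progression-border = mirrored-progression-border
      ; progression-no-shorter-border = mirrored-no-shorter-border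
      ; occurrence-before = mirrored-occurrence-before
      }

  periodic-occurrences : MinAtBoundary RP m → ∀ n → PeriodicOccurrences RP RT m p n
  periodic-occurrences (inj₁ start) n = periodic-occurrences-min-at-start start
  periodic-occurrences (inj₂ end) (suc N) = MirroredCase.periodic-occurrences-min-at-end N end
  periodic-occurrences (inj₂ end) zero = record
    { progression-border = λ u z occs → ⊥-elim (no-room (occs 0 z≤n))
    ; progression-no-shorter-border = λ u z q occs → ⊥-elim (no-room (occs 0 z≤n))
    ; occurrence-before = λ x d occ → ⊥-elim (no-room occ)
    }
    where
    no-room : ∀ {u} → OccursWithin RP RT m 0 u → ⊥
    no-room {u} (u+m≤0 , _) = <⇒≱ 0<m (≤-trans (m≤n+m m u) u+m≤0)

-- Maximal progressions

allPairs-zipWith : ∀ {A : Set} {P : Pred A 0ℓ} {R R′ : Rel A 0ℓ} {xs} →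
                   (∀ {x y} → P x → P y → R x y → R′ x y) → All P xs → AllPairs R xs → AllPairs R′ xs
allPairs-zipWith f [] [] = []
allPairs-zipWith f (px ∷ pxs) (rx ∷ rxs) =
  All.zipWith (λ (py , r) → f px py r) (pxs , rx) ∷ allPairs-zipWith f pxs rxs

spaced-length : ∀ {d lo hi} (xs : List ℕ) → lo ≤ hi → All (λ x → lo ≤ x × x + d ≤ hi) xs →
                AllPairs (λ x y → x + d ≤ y) xs → length xs * d + lo ≤ hi
spaced-length [] lo≤hi [] [] = lo≤hi
spaced-length {d} {lo} {hi} (x ∷ xs) _ ((lo≤x , x+d≤hi) ∷ bounds) (after-x ∷ spaced) = begin
  d + length xs * d + lo   ≤⟨ +-monoʳ-≤ (d + length xs * d) lo≤x ⟩
  d + length xs * d + x    ≡⟨ rearrange d (length xs * d) x ⟩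
  length xs * d + (x + d)  ≤⟨ spaced-length xs x+d≤hi bounds′ spaced ⟩
  hi                       ∎
  where
  open ≤-Reasoning
  bounds′ : All (λ y → x + d ≤ y × y + d ≤ hi) xs
  bounds′ = All.zipWith (λ (x+d≤y , (_ , y+d≤hi)) → x+d≤y , y+d≤hi) (after-x , bounds)
  rearrange : ∀ d k x → d + k + x ≡ k + (x + d)
  rearrange = solve-∀

module Progressions {Q : Pred ℕ 0ℓ} (Q? : Decidable Q) {p n : ℕ} (0<p : 0 < p)
  (bounded : ∀ {i} → Q i → i ≤ n) where

  private
    beyond : ∀ {i} → n < i → ¬ Q i
    beyond n<i q = <⇒≱ n<i (bounded q)

    step : ∀ i v → i + p + v * p ≡ i + suc v * p
    step i v = +-assoc i p (v * p)

    step′ : ∀ i v → i + v * p + p ≡ i + suc v * p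
    step′ i v = trans (+-assoc i (v * p) p) (cong (i +_) (+-comm (v * p) p))

  extent-within : ℕ → ℕ → ℕ
  extent-within zero i = 0
  extent-within (suc fuel) i with Q? (i + p)
  ... | yes _ = suc (extent-within fuel (i + p))
  ... | no _ = 0

  extent : ℕ → ℕ
  extent = extent-within (suc n)

  extent-within-all : ∀ fuel i → Q i → ∀ v → v ≤ extent-within fuel i → Q (i + v * p)
  extent-within-all _ i q zero _ = subst Q (sym (+-identityʳ i)) q
  extent-within-all (suc fuel) i q (suc v) v<e with Q? (i + p) | v<e
  ... | yes q′ | s≤s v≤e = subst Q (step i v) (extent-within-all fuel (i + p) q′ v v≤e)

  extent-within-max : ∀ fuel i → n < i + fuel → ¬ Q (i + suc (extent-within fuel i) * p)
  extent-within-max zero i n<i = beyond (<-≤-trans (subst (n <_) (+-identityʳ i) n<i) (m≤m+n i _))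
  extent-within-max (suc fuel) i n<i+fuel+1 with Q? (i + p)
  ... | no ¬q = ¬q ∘ subst Q (cong (i +_) (+-identityʳ p))
  ... | yes _ =
    extent-within-max fuel (i + p) n<i+p+fuel ∘ subst Q (sym (step i (suc (extent-within fuel (i + p)))))
    where
    n<i+p+fuel : n < i + p + fuel
    n<i+p+fuel = <-≤-trans n<i+fuel+1
                   (≤-trans (+-monoʳ-≤ i (+-monoˡ-≤ fuel 0<p)) (≤-reflexive (sym (+-assoc i p fuel))))

  extent-all : ∀ {i} → Q i → ∀ v → v ≤ extent i → Q (i + v * p)
  extent-all = extent-within-all (suc n) _

  extent-max : ∀ i → ¬ Q (i + suc (extent i) * p)
  extent-max i = extent-within-max (suc n) i (subst (n <_) (sym (+-suc i n)) (s≤s (m≤n+m n i)))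

  extent-maximal : ∀ {i v} → (∀ v′ → v′ ≤ v → Q (i + v′ * p)) → v ≤ extent i
  extent-maximal {i} {v} chain with v ≤? extent i
  ... | yes v≤e = v≤e
  ... | no v≰e = ⊥-elim (extent-max i (chain (suc (extent i)) (≰⇒> v≰e)))

  NoPredecessor : ℕ → Set
  NoPredecessor i = ∀ w → w + p ≡ i → ¬ Q w

  IsStart : ℕ → Set
  IsStart i = Q i × NoPredecessor i

  predecessor? : ∀ i → (∃ λ w → w + p ≡ i × Q w) ⊎ NoPredecessor i
  predecessor? i with p ≤? i
  ... | no p≰i = inj₂ λ w w+p≡i _ → p≰i (subst (p ≤_) w+p≡i (m≤n+m p w))
  ... | yes p≤i with Q? (i ∸ p)
  ...   | yes q = inj₁ (i ∸ p , m∸n+n≡m p≤i , q)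
  ...   | no ¬q = inj₂ λ w w+p≡i → ¬q ∘ subst Q (sym (trans (cong (_∸ p) (sym w+p≡i)) (m+n∸n≡m w p)))

  start? : Decidable IsStart
  start? i with Q? i | predecessor? i
  ... | no ¬q | _ = no (¬q ∘ proj₁)
  ... | yes q | inj₂ none = yes (q , none)
  ... | yes q | inj₁ (w , w+p≡i , qw) = no λ start → proj₂ start w w+p≡i qw

  find-start : ∀ fuel i → i < fuel → Q i →
               ∃ λ s → ∃ λ v → IsStart s × i ≡ s + v * p × (∀ v′ → v′ ≤ v → Q (s + v′ * p))
  find-start (suc fuel) i i<fuel+1 q with predecessor? i
  ... | inj₂ none =
    i , 0 , (q , none) , sym (+-identityʳ i) , λ { zero _ → subst Q (sym (+-identityʳ i)) q }
  ... | inj₁ (w , refl , qw) with find-start fuel w (<-≤-trans (m<m+n w 0<p) (s≤s⁻¹ i<fuel+1)) qw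
  ...   | s , v , start , refl , chain = s , suc v , start , step′ s v , chain′
    where
    chain′ : ∀ v′ → v′ ≤ suc v → Q (s + v′ * p)
    chain′ v′ v′≤v+1 with m≤n⇒m<n∨m≡n v′≤v+1
    ... | inj₁ v′≤v = chain v′ (s≤s⁻¹ v′≤v)
    ... | inj₂ refl = subst Q (step′ s v) q

  starts : List ℕ
  starts = filter start? (upTo (suc n))

  progressions : List (ℕ × ℕ)
  progressions = map (λ s → s , extent s) starts

  IsMaximalProgression : ℕ × ℕ → Set
  IsMaximalProgression (u , z) = (∀ v → v ≤ z → Q (u + v * p)) × NoPredecessor u × ¬ Q (u + suc z * p)

  InProgression : ℕ × ℕ → ℕ → Set
  InProgression (u , z) i = ∃ λ v → v ≤ z × i ≡ u + v * p

  starts-are-starts : All IsStart starts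
  starts-are-starts = all-filter start? (upTo (suc n))

  starts-increasing : AllPairs _<_ starts
  starts-increasing = AllPairs.filter⁺ start? (AllPairs.applyUpTo⁺₁ id (suc n) (λ i<j _ → i<j))

  progressions-maximal : All IsMaximalProgression progressions
  progressions-maximal =
    All.map⁺ (All.map (λ {s} (q , none) → extent-all q , none , extent-max s) starts-are-starts)

  progressions-cover : ∀ i → Q i → Any (λ a → InProgression a i) progressions
  progressions-cover i q with find-start (suc i) i ≤-refl q
  ... | s , v , start , i≡ , chain =
    Any.map⁺ (Any.map (λ { refl → v , extent-maximal chain , i≡ }) s∈starts)
    where
    s∈starts : s ∈ starts
    s∈starts = ∈-filter⁺ start? (∈-upTo⁺ (s≤s (bounded (proj₁ start)))) start

  module _ {m : ℕ} (p+p≤m : p + p ≤ m)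
    (close : ∀ {x s} → Q x → IsStart s → x < s → x + m < s + p) where

    progression-before-start : ∀ {s₁ s₂} → IsStart s₁ → IsStart s₂ → s₁ < s₂ →
                               ∀ v → v ≤ extent s₁ → s₁ + v * p < s₂
    progression-before-start {s₁} start₁ start₂ s₁<s₂ zero _ = subst (_< _) (sym (+-identityʳ s₁)) s₁<s₂
    progression-before-start {s₁} {s₂} start₁ start₂ s₁<s₂ (suc v) v<e =
      subst (_< s₂) (step′ s₁ v) (+-cancelʳ-< p (s₁ + v * p + p) s₂ (begin-strict
        s₁ + v * p + p + p   ≡⟨ +-assoc (s₁ + v * p) p p ⟩
        s₁ + v * p + (p + p) ≤⟨ +-monoʳ-≤ (s₁ + v * p) p+p≤m ⟩
        s₁ + v * p + m       <⟨ close (extent-all (proj₁ start₁) v (<⇒≤ v<e)) start₂ x<s₂ ⟩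
        s₂ + p               ∎))
      where
      open ≤-Reasoning
      x<s₂ : s₁ + v * p < s₂
      x<s₂ = progression-before-start start₁ start₂ s₁<s₂ v (<⇒≤ v<e)

    progression-gap : ∀ {s₁ s₂} → IsStart s₁ → IsStart s₂ → s₁ < s₂ → s₁ + extent s₁ * p + m < s₂ + p
    progression-gap start₁ start₂ s₁<s₂ =
      close (extent-all (proj₁ start₁) _ ≤-refl) start₂
        (progression-before-start start₁ start₂ s₁<s₂ _ ≤-refl)

    progressions-separated : AllPairs (λ a b → proj₁ a + proj₂ a * p + m < proj₁ b + p) progressions
    progressions-separated =
      AllPairs.map⁺ (allPairs-zipWith progression-gap starts-are-starts starts-increasing)

-- From strings to position orders

module StringOrders (O : StrictTotalOrder 0ℓ 0ℓ 0ℓ) where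
  open CT O
  open StrictTotalOrder O using (compare; module Eq; <-respʳ-≈; <-respˡ-≈)
    renaming (Carrier to A; _<_ to _⊏_; _≈_ to _≋_; trans to ⊏-trans; irrefl to ⊏-irrefl)

  rank : (ℕ → A) → Rel ℕ 0ℓ
  rank f x y = f x ⊏ f y ⊎ (f x ≋ f y × x < y)

  rank-order : ∀ f → IsPositionOrder (rank f)
  rank-order f = record { irreflexive = irr ; transitive = trans′ ; connected = conn }
    where
    irr : ∀ x → ¬ rank f x x
    irr x (inj₁ fx⊏fx) = ⊏-irrefl Eq.refl fx⊏fx
    irr x (inj₂ (_ , x<x)) = <-irrefl refl x<x
    trans′ : ∀ {x y z} → rank f x y → rank f y z → rank f x z
    trans′ (inj₁ x⊏y) (inj₁ y⊏z) = inj₁ (⊏-trans x⊏y y⊏z)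
    trans′ (inj₁ x⊏y) (inj₂ (y≋z , _)) = inj₁ (<-respʳ-≈ y≋z x⊏y)
    trans′ (inj₂ (x≋y , _)) (inj₁ y⊏z) = inj₁ (<-respˡ-≈ (Eq.sym x≋y) y⊏z)
    trans′ (inj₂ (x≋y , x<y)) (inj₂ (y≋z , y<z)) = inj₂ (Eq.trans x≋y y≋z , <-trans x<y y<z)
    conn : ∀ x y → x ≢ y → rank f x y ⊎ rank f y x
    conn x y x≢y with compare (f x) (f y)
    ... | tri< x⊏y _ _ = inj₁ (inj₁ x⊏y)
    ... | tri> _ _ y⊏x = inj₂ (inj₁ y⊏x)
    ... | tri≈ _ x≋y _ with <-cmp x y
    ...   | tri< x<y _ _ = inj₁ (inj₂ (x≋y , x<y))
    ...   | tri≈ _ x≡y _ = ⊥-elim (x≢y x≡y)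
    ...   | tri> _ _ y<x = inj₂ (inj₂ (Eq.sym x≋y , y<x))

  rank-≈ : ∀ {f g} s → (∀ k → k < n → f k ≡ g (s + k)) → rank f ≈[ n ] shift s (rank g)
  rank-≈ {f = f} {g} s f≡g b<n = argMin-map λ {x} {y} _ x≤b _ y≤b →
    λ { (inj₁ x⊏y) → inj₁ (subst₂ _⊏_ (f≡g x (≤-<-trans x≤b b<n)) (f≡g y (≤-<-trans y≤b b<n)) x⊏y)
      ; (inj₂ (x≋y , x<y)) → inj₂ (subst₂ _≋_ (f≡g x (≤-<-trans x≤b b<n)) (f≡g y (≤-<-trans y≤b b<n)) x≋y
                                  , +-monoʳ-< s x<y) }

  module Positions (d : A) where

    -- The default d is only read past the end of a string, where no window looks.
    nth : String → ℕ → A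
    nth [] k = d
    nth (x ∷ xs) zero = x
    nth (x ∷ xs) (suc k) = nth xs k

    ⟦_⟧ : String → Rel ℕ 0ℓ
    ⟦ S ⟧ = rank (nth S)

    nth-take : ∀ t S → k < t → nth (take t S) k ≡ nth S k
    nth-take (suc t) [] _ = refl
    nth-take {zero} (suc t) (x ∷ xs) _ = refl
    nth-take {suc k} (suc t) (x ∷ xs) k<t = nth-take t xs (s≤s⁻¹ k<t)

    nth-drop : ∀ j S → nth (drop j S) k ≡ nth S (j + k)
    nth-drop zero S = refl
    nth-drop (suc j) [] = refl
    nth-drop (suc j) (x ∷ xs) = nth-drop j xs

    take-≈ : ∀ t S → ⟦ take t S ⟧ ≈[ t ] ⟦ S ⟧
    take-≈ t S = rank-≈ {f = nth (take t S)} {g = nth S} 0 λ k k<t → nth-take t S k<t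

    drop-≈ : ∀ j S → ⟦ drop j S ⟧ ≈[ n ] shift j ⟦ S ⟧
    drop-≈ j S = rank-≈ {f = nth (drop j S)} {g = nth S} j λ k _ → nth-drop j S

    _⊑_ : A → A → Set
    x ⊑ y = x ⊏ y ⊎ x ≋ y

    private
      ⊑-rank : ∀ {x xs c k} → x ⊑ nth xs c → ⟦ xs ⟧ c k → x ⊑ nth xs k
      ⊑-rank (inj₁ x⊏c) (inj₁ c⊏k) = inj₁ (⊏-trans x⊏c c⊏k)
      ⊑-rank (inj₁ x⊏c) (inj₂ (c≋k , _)) = inj₁ (<-respʳ-≈ c≋k x⊏c)
      ⊑-rank (inj₂ x≋c) (inj₁ c⊏k) = inj₁ (<-respˡ-≈ (Eq.sym x≋c) c⊏k)
      ⊑-rank (inj₂ x≋c) (inj₂ (c≋k , _)) = inj₂ (Eq.trans x≋c c≋k)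

      ⊑-head : ∀ {x xs k} → x ⊑ nth xs k → ⟦ x ∷ xs ⟧ 0 (suc k)
      ⊑-head (inj₁ x⊏k) = inj₁ x⊏k
      ⊑-head (inj₂ x≋k) = inj₂ (x≋k , z<s)

      rank-tail : ∀ {x xs i j} → ⟦ xs ⟧ i j → ⟦ x ∷ xs ⟧ (suc i) (suc j)
      rank-tail (inj₁ i⊏j) = inj₁ i⊏j
      rank-tail (inj₂ (i≋j , i<j)) = inj₂ (i≋j , s≤s i<j)

    argMin-cons-tail : ∀ {x xs} → ArgMin ⟦ xs ⟧ 0 b c → nth xs c ⊏ x →
                       ArgMin ⟦ x ∷ xs ⟧ 0 (suc b) (suc c)
    argMin-cons-tail {x = x} {xs} m c⊏x = argMin z≤n (s≤s (upper m)) λ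
      { zero _ _ _ → inj₁ c⊏x
      ; (suc k) _ k<b+1 k≢c → rank-tail {x = x} {xs} (least m k z≤n (s≤s⁻¹ k<b+1) (k≢c ∘ cong suc)) }

    argMin-cons-head : ∀ {x xs} → ArgMin ⟦ xs ⟧ 0 b c → x ⊑ nth xs c → ArgMin ⟦ x ∷ xs ⟧ 0 (suc b) 0
    argMin-cons-head {b = b} {c = c} {x = x} {xs} m x⊑c = argMin z≤n z≤n least′
      where
      least′ : ∀ k → 0 ≤ k → k ≤ suc b → k ≢ 0 → ⟦ x ∷ xs ⟧ 0 k
      least′ zero _ _ k≢0 = ⊥-elim (k≢0 refl)
      least′ (suc k) _ k<b+1 _ with k ≟ c
      ... | yes refl = ⊑-head {xs = xs} x⊑c
      ... | no k≢c = ⊑-head {xs = xs} (⊑-rank {xs = xs} x⊑c (least m k z≤n (s≤s⁻¹ k<b+1) k≢c))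

    lm-index : A → String → ℕ
    lm-index x xs = proj₂ (lm x xs)

    lm-value : ∀ x xs → proj₁ (lm x xs) ≡ nth (x ∷ xs) (lm-index x xs)
    lm-value x [] = refl
    lm-value x (y ∷ ys) with lm y ys | lm-value y ys
    ... | v , t | v≡ with compare v x
    ...   | tri< _ _ _ = v≡
    ...   | tri≈ _ _ _ = refl
    ...   | tri> _ _ _ = refl

    lm-argMin : ∀ x xs → ArgMin ⟦ x ∷ xs ⟧ 0 (length xs) (lm-index x xs)
    lm-argMin x [] = argMin-singleton
    lm-argMin x (y ∷ ys) with lm y ys | lm-value y ys | lm-argMin y ys
    ... | v , t | v≡ | m with compare v x
    ...   | tri< v⊏x _ _ = argMin-cons-tail m (subst (_⊏ x) v≡ v⊏x)
    ...   | tri≈ _ v≋x _ = argMin-cons-head m (inj₂ (subst (x ≋_) v≡ (Eq.sym v≋x)))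
    ...   | tri> _ _ x⊏v = argMin-cons-head m (inj₁ (subst (x ⊏_) v≡ x⊏v))

    ⟦⟧-order : ∀ S → IsPositionOrder ⟦ S ⟧
    ⟦⟧-order S = rank-order (nth S)

    take-≈⁻ : ∀ t S → ⟦ S ⟧ ≈[ t ] ⟦ take t S ⟧
    take-≈⁻ t S = ≈-sym (⟦⟧-order (take t S)) (⟦⟧-order S) (take-≈ t S)

    drop-≈⁻ : ∀ j S → shift j ⟦ S ⟧ ≈[ n ] ⟦ drop j S ⟧
    drop-≈⁻ j S = ≈-sym (⟦⟧-order (drop j S)) (shift-order j (⟦⟧-order S)) (drop-≈ j S)

    size : Tree → ℕ
    size leaf = 0
    size (node l r) = suc (size l + size r)

    left right : Tree → Tree
    left leaf = leaf
    left (node l r) = l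
    right leaf = leaf
    right (node l r) = r

    length-take≤ : ∀ t (S : String) → length (take t S) ≤ t
    length-take≤ t S = ≤-trans (≤-reflexive (length-take t S)) (m⊓n≤m t _)

    length-take-≤ : ∀ t (S : String) → t ≤ length S → length (take t S) ≡ t
    length-take-≤ t S t≤ = trans (length-take t S) (m≤n⇒m⊓n≡m t≤)

    size-ctF : ∀ k S → length S ≤ k → size (ctF k S) ≡ length S
    size-ctF zero [] _ = refl
    size-ctF (suc k) [] _ = refl
    size-ctF (suc k) S@(x ∷ xs) (s≤s ≤k) = cong suc (begin
      size (ctF k (take t S)) + size (ctF k (drop t xs))
        ≡⟨ cong₂ _+_ (size-ctF k (take t S) (subst (_≤ k) (sym len-take) (≤-trans t≤ ≤k)))
                     (size-ctF k (drop t xs)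
                       (subst (_≤ k) (sym (length-drop t xs)) (≤-trans (m∸n≤m _ t) ≤k))) ⟩
      length (take t S) + length (drop t xs)
        ≡⟨ cong₂ _+_ len-take (length-drop t xs) ⟩
      t + (length xs ∸ t)
        ≡⟨ m+[n∸m]≡n t≤ ⟩
      length xs ∎)
      where
      open ≡-Reasoning
      t : ℕ
      t = lm-index x xs
      t≤ : t ≤ length xs
      t≤ = upper (lm-argMin x xs)
      len-take : length (take t S) ≡ t
      len-take = length-take-≤ t S (m≤n⇒m≤1+n t≤)

    ≈-take : ∀ t S S′ → t ≤ n → ⟦ S ⟧ ≈[ n ] ⟦ S′ ⟧ → ⟦ take t S ⟧ ≈[ t ] ⟦ take t S′ ⟧
    ≈-take t S S′ t≤n S≈S′ = ≈-trans (take-≈ t S) (≈-trans (≈-weaken t≤n S≈S′) (take-≈⁻ t S′))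

    ≈-take⁻ : ∀ t S S′ → ⟦ take t S ⟧ ≈[ t ] ⟦ take t S′ ⟧ → ⟦ S ⟧ ≈[ t ] ⟦ S′ ⟧
    ≈-take⁻ t S S′ ≈take = ≈-trans (take-≈⁻ t S) (≈-trans ≈take (take-≈ t S′))

    ≈-drop : ∀ j S S′ → ⟦ S ⟧ ≈[ n ] ⟦ S′ ⟧ → ⟦ drop j S ⟧ ≈[ n ∸ j ] ⟦ drop j S′ ⟧
    ≈-drop j S S′ S≈S′ = ≈-trans (drop-≈ j S) (≈-trans (≈-shift j S≈S′) (drop-≈⁻ j S′))

    ≈-drop⁻ : ∀ j S S′ → ⟦ drop j S ⟧ ≈[ n ] ⟦ drop j S′ ⟧ → shift j ⟦ S ⟧ ≈[ n ] shift j ⟦ S′ ⟧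
    ≈-drop⁻ j S S′ ≈drop = ≈-trans (drop-≈⁻ j S) (≈-trans ≈drop (drop-≈ j S′))

    ≈⇒ctF≡ : ∀ k S S′ → length S ≡ length S′ → ⟦ S ⟧ ≈[ length S ] ⟦ S′ ⟧ → ctF k S ≡ ctF k S′
    ≈⇒ctF≡ zero _ _ _ _ = refl
    ≈⇒ctF≡ (suc k) [] [] _ _ = refl
    ≈⇒ctF≡ (suc k) S@(x ∷ xs) S′@(x′ ∷ xs′) len≡ S≈S′ = cong₂ node
      (subst (λ i → ctF k (take t S) ≡ ctF k (take i S′)) t≡t′ (≈⇒ctF≡ k _ _ take-length left-≈))
      (subst (λ i → ctF k (drop t xs) ≡ ctF k (drop i xs′)) t≡t′ (≈⇒ctF≡ k _ _ drop-length right-≈))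
      where
      t : ℕ
      t = lm-index x xs
      xs≡ : length xs ≡ length xs′
      xs≡ = suc-injective len≡
      t≡t′ : t ≡ lm-index x′ xs′
      t≡t′ = argMin-unique (⟦⟧-order S′) (S≈S′ ≤-refl (lm-argMin x xs))
               (argMin-≡ refl (sym xs≡) refl (lm-argMin x′ xs′))
      take-length : length (take t S) ≡ length (take t S′)
      take-length = trans (length-take t S) (trans (cong (t ⊓_) len≡) (sym (length-take t S′)))
      drop-length : length (drop t xs) ≡ length (drop t xs′)
      drop-length = trans (length-drop t xs) (trans (cong (_∸ t) xs≡) (sym (length-drop t xs′)))
      left-≈ : ⟦ take t S ⟧ ≈[ length (take t S) ] ⟦ take t S′ ⟧
      left-≈ = ≈-weaken (length-take≤ t S)
                 (≈-take t S S′ (m≤n⇒m≤1+n (upper (lm-argMin x xs))) S≈S′)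
      right-≈ : ⟦ drop t xs ⟧ ≈[ length (drop t xs) ] ⟦ drop t xs′ ⟧
      right-≈ = subst (λ l → ⟦ drop t xs ⟧ ≈[ l ] ⟦ drop t xs′ ⟧) (sym (length-drop t xs))
                  (≈-drop (suc t) S S′ S≈S′)

    ctF≡⇒length≡ : ∀ k S S′ → length S ≤ k → length S′ ≤ k → ctF k S ≡ ctF k S′ → length S ≡ length S′
    ctF≡⇒length≡ k S S′ S≤k S′≤k tree≡ =
      trans (sym (size-ctF k S S≤k)) (trans (cong size tree≡) (size-ctF k S′ S′≤k))

    size-left-ctF : ∀ k x xs → length xs ≤ k → size (left (ctF (suc k) (x ∷ xs))) ≡ lm-index x xs
    size-left-ctF k x xs xs≤k =
      trans (size-ctF k (take t (x ∷ xs)) (≤-trans (length-take≤ t (x ∷ xs)) (≤-trans t≤xs xs≤k)))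
            (length-take-≤ t (x ∷ xs) (m≤n⇒m≤1+n t≤xs))
      where
      t : ℕ
      t = lm-index x xs
      t≤xs : t ≤ length xs
      t≤xs = upper (lm-argMin x xs)

    ctF≡⇒≈ : ∀ k S S′ → length S ≤ k → length S′ ≤ k → ctF k S ≡ ctF k S′ → ⟦ S ⟧ ≈[ length S ] ⟦ S′ ⟧
    ctF≡⇒≈ k [] S′ _ _ _ ()
    ctF≡⇒≈ zero (x ∷ xs) S′ () _ _
    ctF≡⇒≈ (suc k) (x ∷ xs) [] _ _ ()
    ctF≡⇒≈ (suc k) S@(x ∷ xs) S′@(x′ ∷ xs′) (s≤s xs≤k) (s≤s xs′≤k) tree≡ =
      ≈-split-at-min (⟦⟧-order S) (lm-argMin x xs) (argMin-≡ refl (sym xs≡) (sym t≡t′) (lm-argMin x′ xs′))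
        (≈-take⁻ t S S′ (subst (λ l → ⟦ take t S ⟧ ≈[ l ] ⟦ take t S′ ⟧) (length-take-≤ t S t≤S) left-≈))
        (≈-drop⁻ (suc t) S S′
          (subst (λ l → ⟦ drop t xs ⟧ ≈[ l ] ⟦ drop t xs′ ⟧) (length-drop t xs) right-≈))
      where
      t : ℕ
      t = lm-index x xs
      t≤S : t ≤ length S
      t≤S = m≤n⇒m≤1+n (upper (lm-argMin x xs))
      t≤k : t ≤ k
      t≤k = ≤-trans (upper (lm-argMin x xs)) xs≤k
      drop≤ : ∀ (W : String) → length W ≤ k → length (drop t W) ≤ k
      drop≤ W W≤k = ≤-trans (≤-reflexive (length-drop t W)) (≤-trans (m∸n≤m _ t) W≤k)
      xs≡ : length xs ≡ length xs′
      xs≡ = suc-injective (ctF≡⇒length≡ (suc k) S S′ (s≤s xs≤k) (s≤s xs′≤k) tree≡)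
      t≡t′ : t ≡ lm-index x′ xs′
      t≡t′ = trans (sym (size-left-ctF k x xs xs≤k))
               (trans (cong (size ∘ left) tree≡) (size-left-ctF k x′ xs′ xs′≤k))
      left-≈ : ⟦ take t S ⟧ ≈[ length (take t S) ] ⟦ take t S′ ⟧
      left-≈ = ctF≡⇒≈ k (take t S) (take t S′)
                 (≤-trans (length-take≤ t S) t≤k) (≤-trans (length-take≤ t S′) t≤k)
                 (subst (λ i → ctF k (take t S) ≡ ctF k (take i S′)) (sym t≡t′) (cong left tree≡))
      right-≈ : ⟦ drop t xs ⟧ ≈[ length (drop t xs) ] ⟦ drop t xs′ ⟧
      right-≈ = ctF≡⇒≈ k (drop t xs) (drop t xs′) (drop≤ xs xs≤k) (drop≤ xs′ xs′≤k)
                  (subst (λ i → ctF k (drop t xs) ≡ ctF k (drop i xs′)) (sym t≡t′) (cong right tree≡))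

    ≈CT⇒≈ : ∀ {S S′ : String} → S ≈CT S′ → length S ≡ length S′ × ⟦ S ⟧ ≈[ length S ] ⟦ S′ ⟧
    ≈CT⇒≈ {S} {S′} ct =
      len≡ , ctF≡⇒≈ (length S) S S′ ≤-refl (≤-reflexive (sym len≡))
               (trans ct (cong (λ k → ctF k S′) (sym len≡)))
      where
      len≡ : length S ≡ length S′
      len≡ = trans (sym (size-ctF _ S ≤-refl)) (trans (cong size ct) (size-ctF _ S′ ≤-refl))

    ≈⇒≈CT : ∀ {S S′ : String} → length S ≡ length S′ → ⟦ S ⟧ ≈[ length S ] ⟦ S′ ⟧ → S ≈CT S′
    ≈⇒≈CT {S} {S′} len≡ S≈S′ = trans (≈⇒ctF≡ (length S) S S′ len≡ S≈S′) (cong (λ k → ctF k S′) len≡)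

    window : String → ℕ → ℕ → String
    window T u L = sub T (suc u) (u + L)

    window-≈ : ∀ T u L → ⟦ window T u L ⟧ ≈[ L ] shift u ⟦ T ⟧
    window-≈ T u L = rank-≈ {f = nth (window T u L)} {g = nth T} u λ k k<L →
      trans (nth-take _ (drop u T) (subst (k <_) (sym (m+n∸m≡n u L)) k<L)) (nth-drop u T)

    window-≈⁻ : ∀ T u L → shift u ⟦ T ⟧ ≈[ L ] ⟦ window T u L ⟧
    window-≈⁻ T u L = ≈-sym (⟦⟧-order (window T u L)) (shift-order u (⟦⟧-order T)) (window-≈ T u L)

    length-window : ∀ T u L → u + L ≤ length T → length (window T u L) ≡ L
    length-window T u L u+L≤ = trans (length-take-≤ _ (drop u T) fits) (m+n∸m≡n u L)
      where
      fits : u + L ∸ u ≤ length (drop u T)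
      fits = subst (u + L ∸ u ≤_) (sym (length-drop u T)) (∸-monoˡ-≤ u u+L≤)

    -- `Occ` counts positions from 1, position orders from 0.
    occ⇒occursWithin : ∀ {P T} → Occ P T (suc u) → OccursWithin ⟦ P ⟧ ⟦ T ⟧ (length P) (length T) u
    occ⇒occursWithin {u} {P} {T} (_ , fits , ct) =
      s≤s⁻¹ (subst (suc u + length P ≤_) (+-comm (length T) 1) fits) ,
      ≈-trans (proj₂ (≈CT⇒≈ ct)) (window-≈ T u (length P))

    occursWithin⇒occ : ∀ {P T} → OccursWithin ⟦ P ⟧ ⟦ T ⟧ (length P) (length T) u → Occ P T (suc u)
    occursWithin⇒occ {u} {P} {T} (fits , P≈) =
      s≤s z≤n , subst (suc u + length P ≤_) (+-comm 1 (length T)) (s≤s fits) ,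
      ≈⇒≈CT (sym (length-window T u (length P) fits)) (≈-trans P≈ (window-≈⁻ T u (length P)))

    private
      length-take∸ : ∀ (S : String) q → length (take (length S ∸ q) S) ≡ length S ∸ q
      length-take∸ S q = length-take-≤ (length S ∸ q) S (m∸n≤m _ q)

    border⇒hasBorder : ∀ S q → take (length S ∸ q) S ≈CT drop q S → HasBorder ⟦ S ⟧ (length S) q
    border⇒hasBorder S q ct =
      ≈-trans (take-≈⁻ _ S)
        (≈-trans (subst (λ l → ⟦ take (length S ∸ q) S ⟧ ≈[ l ] ⟦ drop q S ⟧) (length-take∸ S q)
                   (proj₂ (≈CT⇒≈ ct)))
          (drop-≈ q S))

    hasBorder⇒border : ∀ S q → HasBorder ⟦ S ⟧ (length S) q → take (length S ∸ q) S ≈CT drop q S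
    hasBorder⇒border S q border =
      ≈⇒≈CT (trans (length-take∸ S q) (sym (length-drop q S)))
        (subst (λ l → ⟦ take (length S ∸ q) S ⟧ ≈[ l ] ⟦ drop q S ⟧) (sym (length-take∸ S q))
          (≈-trans (take-≈ _ S) (≈-trans border (drop-≈⁻ q S))))

    lMinAtEnd⇒boundary : ∀ S → LMinAtEnd S → MinAtBoundary ⟦ S ⟧ (length S)
    lMinAtEnd⇒boundary (x ∷ xs) (inj₁ t≡0) = inj₁ (argMin-≡ refl refl t≡0 (lm-argMin x xs))
    lMinAtEnd⇒boundary (x ∷ xs) (inj₂ t≡end) = inj₂ (argMin-≡ refl refl t≡end (lm-argMin x xs))

    boundary⇒lMinAtEnd : ∀ S → 0 < length S → MinAtBoundary ⟦ S ⟧ (length S) → LMinAtEnd S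
    boundary⇒lMinAtEnd (x ∷ xs) _ (inj₁ start) =
      inj₁ (argMin-unique (⟦⟧-order (x ∷ xs)) (lm-argMin x xs) start)
    boundary⇒lMinAtEnd (x ∷ xs) _ (inj₂ end) =
      inj₂ (argMin-unique (⟦⟧-order (x ∷ xs)) (lm-argMin x xs) end)

    blockPeriod⇒isBlockPeriod : ∀ S → BlockPeriod S q → IsBlockPeriod ⟦ S ⟧ (length S) q
    blockPeriod⇒isBlockPeriod S (q∣ , (0<q , q≤ , ct) , end) = record
      { divides-length = q∣ ; positive = 0<q ; at-most-length = q≤
      ; has-border = border⇒hasBorder S _ ct ; min-at-boundary = lMinAtEnd⇒boundary S end }

    isBlockPeriod⇒blockPeriod : ∀ S → IsBlockPeriod ⟦ S ⟧ (length S) q → BlockPeriod S q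
    isBlockPeriod⇒blockPeriod S block =
      divides-length , (positive , at-most-length , hasBorder⇒border S _ has-border) ,
      boundary⇒lMinAtEnd S (<-≤-trans positive at-most-length) min-at-boundary
      where open IsBlockPeriod block

    window-blockPeriod⇒ : ∀ T u L → u + L ≤ length T → BlockPeriod (window T u L) q →
                          IsBlockPeriod (shift u ⟦ T ⟧) L q
    window-blockPeriod⇒ {q} T u L fits block =
      blockPeriod-≈ (⟦⟧-order (window T u L)) (shift-order u (⟦⟧-order T)) (window-≈ T u L)
        (subst (λ l → IsBlockPeriod ⟦ window T u L ⟧ l q) (length-window T u L fits)
          (blockPeriod⇒isBlockPeriod (window T u L) block))

    window-blockPeriod⇐ : ∀ T u L → u + L ≤ length T → IsBlockPeriod (shift u ⟦ T ⟧) L q →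
                          BlockPeriod (window T u L) q
    window-blockPeriod⇐ {q} T u L fits block =
      isBlockPeriod⇒blockPeriod (window T u L)
        (subst (λ l → IsBlockPeriod ⟦ window T u L ⟧ l q) (sym (length-window T u L fits))
          (blockPeriod-≈ (shift-order u (⟦⟧-order T)) (⟦⟧-order (window T u L)) (window-≈⁻ T u L) block))

_≟ᵀ_ : DecidableEquality Tree
leaf ≟ᵀ leaf = yes refl
leaf ≟ᵀ node _ _ = no λ ()
node _ _ ≟ᵀ leaf = no λ ()
node l r ≟ᵀ node l′ r′ with l ≟ᵀ l′ | r ≟ᵀ r′
... | yes refl | yes refl = yes refl
... | no l≢l′ | _ = no λ { refl → l≢l′ refl }
... | _ | no r≢r′ = no λ { refl → r≢r′ refl }

module PeriodicPatternOccurrences (O : StrictTotalOrder 0ℓ 0ℓ 0ℓ) where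
  open CT O
  open StringOrders O
  open StrictTotalOrder O using () renaming (Carrier to A)

  occ? : ∀ P T → Decidable (Occ P T)
  occ? P T i =
    (1 ≤? i) ×-dec (i + length P ≤? length T + 1) ×-dec (CTree P ≟ᵀ CTree (sub T i (i + length P ∸ 1)))

  module _ (x₀ : A) (xs₀ T : String) {p : ℕ} (min-block : MinBlockPeriod (x₀ ∷ xs₀) p)
    (p+p≤m : p + p ≤ length (x₀ ∷ xs₀)) where

    open Positions x₀

    private
      P : String
      P = x₀ ∷ xs₀
      m : ℕ
      m = length P

      block : IsBlockPeriod ⟦ P ⟧ m p
      block = blockPeriod⇒isBlockPeriod P (proj₁ min-block)

      open IsBlockPeriod block

      minimal : ∀ g → IsBlockPeriod ⟦ P ⟧ m g → p ≤ g
      minimal g block-g = proj₂ min-block g (isBlockPeriod⇒blockPeriod P block-g)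

      facts : PeriodicOccurrences ⟦ P ⟧ ⟦ T ⟧ m p (length T)
      facts = periodic-occurrences (⟦⟧-order P) (⟦⟧-order T) positive divides-length p+p≤m has-border
                minimal min-at-boundary (length T)

      open PeriodicOccurrences facts

      occ-bounded : ∀ {i} → Occ P T i → i ≤ length T
      occ-bounded {i} (_ , i+m≤n+1 , _) = s≤s⁻¹ (begin
        suc i        ≡⟨ +-comm 1 i ⟩
        i + 1        ≤⟨ +-monoʳ-≤ i (s≤s z≤n) ⟩
        i + m        ≤⟨ i+m≤n+1 ⟩
        length T + 1 ≡⟨ +-comm (length T) 1 ⟩
        suc (length T) ∎)
        where open ≤-Reasoning

    open Progressions (occ? P T) positive occ-bounded public

    private
      -- If the occurrence x overlapped the start s in p or more positions, `occurrence-before`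
      -- would give an occurrence p positions before s.
      occurrence-far-before-start : ∀ {x s} → Occ P T x → IsStart s → x < s → x + m < s + p
      occurrence-far-before-start {zero} (() , _) _ _
      occurrence-far-before-start {suc x} {s} occ-x (occ-s , none) x<s with s + p ≤? suc x + m
      ... | no far = ≰⇒> far
      ... | yes near
        with occurrence-before x (s ∸ suc x) (occ⇒occursWithin occ-x)
               (occ⇒occursWithin (subst (Occ P T) (sym x+d≡s) occ-s)) (m<n⇒0<n∸m x<s) d+p≤m
        where
        x+d≡s : suc x + (s ∸ suc x) ≡ s
        x+d≡s = m+[n∸m]≡n (<⇒≤ x<s)
        d+p≤m : s ∸ suc x + p ≤ m
        d+p≤m = +-cancelˡ-≤ (suc x) _ _
                  (subst (_≤ suc x + m) (trans (cong (_+ p) (sym x+d≡s)) (+-assoc (suc x) _ p)) near)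
      ...   | y , y+p≡x+d , within-y =
        ⊥-elim (none (suc y) (trans (cong suc y+p≡x+d) (m+[n∸m]≡n (<⇒≤ x<s)))
                 (occursWithin⇒occ within-y))

    progressions-gaps : AllPairs (λ a b → proj₁ a + proj₂ a * p + m < proj₁ b + p) progressions
    progressions-gaps = progressions-separated p+p≤m occurrence-far-before-start

    progressions-count : length progressions * m ≤ 2 * length T
    progressions-count = begin
      length progressions * m                ≡⟨ cong (_* m) (length-map _ starts) ⟩
      #starts * m                            ≤⟨ *-monoʳ-≤ #starts m≤2[m-p] ⟩
      #starts * ((m ∸ p) + (m ∸ p))          ≡⟨ *-distribˡ-+ #starts (m ∸ p) (m ∸ p) ⟩
      #starts * (m ∸ p) + #starts * (m ∸ p)  ≤⟨ +-mono-≤ starts-fit starts-fit ⟩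
      length T + length T                    ≡⟨ cong (length T +_) (+-identityʳ (length T)) ⟨
      2 * length T                           ∎
      where
      open ≤-Reasoning
      #starts : ℕ
      #starts = length starts
      p≤m : p ≤ m
      p≤m = ≤-trans (m≤m+n p p) p+p≤m
      +m≡+[m-p]+p : ∀ x → x + m ≡ x + (m ∸ p) + p
      +m≡+[m-p]+p x = trans (cong (x +_) (sym (m∸n+n≡m p≤m))) (sym (+-assoc x (m ∸ p) p))
      m≤2[m-p] : m ≤ (m ∸ p) + (m ∸ p)
      m≤2[m-p] = ≤-trans (≤-reflexive (sym (m∸n+n≡m p≤m)))
                   (+-monoʳ-≤ (m ∸ p) (subst (_≤ m ∸ p) (m+n∸n≡m p p) (∸-monoˡ-≤ p p+p≤m)))
      fits : ∀ {s} → IsStart s → 0 ≤ s × s + (m ∸ p) ≤ length T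
      fits {s} ((_ , s+m≤n+1 , _) , _) = z≤n , +-cancelʳ-≤ 1 _ _
        (≤-trans (+-monoʳ-≤ (s + (m ∸ p)) positive) (subst (_≤ length T + 1) (+m≡+[m-p]+p s) s+m≤n+1))
      spaced : AllPairs (λ x y → x + (m ∸ p) ≤ y) starts
      spaced = AllPairs.map (λ {x} {y} gap → <⇒≤ (+-cancelʳ-< p _ y
                 (≤-<-trans (≤-trans (≤-reflexive (sym (+m≡+[m-p]+p x))) (+-monoˡ-≤ m (m≤m+n x _))) gap)))
                 (AllPairs.map⁻ progressions-gaps)
      starts-fit : #starts * (m ∸ p) ≤ length T
      starts-fit = subst (_≤ length T) (+-identityʳ _)
                     (spaced-length starts z≤n (All.map fits starts-are-starts) spaced)

    private
      module Run {u z : ℕ} (chain : ∀ v → v ≤ z → Occ P T (suc u + v * p))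
        (no-before : NoPredecessor (suc u)) (no-after : ¬ Occ P T (suc u + suc z * p)) where

        L : ℕ
        L = z * p + m

        within : ∀ v → v ≤ z → OccursWithin ⟦ P ⟧ ⟦ T ⟧ m (length T) (u + v * p)
        within v v≤z = occ⇒occursWithin (chain v v≤z)

        m≤L : m ≤ L
        m≤L = m≤n+m m (z * p)

        fits : u + L ≤ length T
        fits = subst (_≤ length T) (+-assoc u (z * p) m) (proj₁ (within z ≤-refl))

        run-block : IsBlockPeriod (shift u ⟦ T ⟧) L p
        run-block = record
          { divides-length = ∣m∣n⇒∣m+n (n∣m*n z) divides-length ; positive = positive
          ; at-most-length = ≤-trans at-most-length m≤L
          ; has-border = proj₁ (progression-border u z within)
          ; min-at-boundary = proj₂ (progression-border u z within) }

        run-minimal : ∀ q → IsBlockPeriod (shift u ⟦ T ⟧) L q → p ≤ q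
        run-minimal q block-q with q <? p
        ... | yes q<p = ⊥-elim (progression-no-shorter-border u z q within
                                  (IsBlockPeriod.positive block-q) q<p
                                  (IsBlockPeriod.has-border block-q))
        ... | no q≮p = ≮⇒≥ q≮p

        left-maximal : suc u ≤ p ⊎ ¬ BlockPeriod (sub T (suc u ∸ p) (u + L)) p
        left-maximal with suc u ≤? p
        ... | yes u<p = inj₁ u<p
        ... | no u≮p =
          inj₂ λ block → no-before (suc u′) (cong suc u′+p≡u) (occursWithin⇒occ (within-u′ block))
          where
          p≤u : p ≤ u
          p≤u = s≤s⁻¹ (≰⇒> u≮p)
          u′ : ℕ
          u′ = u ∸ p
          u′+p≡u : u′ + p ≡ u
          u′+p≡u = m∸n+n≡m p≤u
          fits′ : u′ + (p + L) ≤ length T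
          fits′ = subst (_≤ length T) (trans (cong (_+ L) (sym u′+p≡u)) (+-assoc u′ p L)) fits
          within-u′ : BlockPeriod (sub T (suc u ∸ p) (u + L)) p →
                      OccursWithin ⟦ P ⟧ ⟦ T ⟧ m (length T) u′
          within-u′ block =
            ≤-trans (+-monoˡ-≤ m (m≤m+n u′ p))
              (subst (λ v → v + m ≤ length T) (trans (+-identityʳ u) (sym u′+p≡u))
                (proj₁ (within 0 z≤n))) ,
            border-transport⁻ {w = 0} (shift-order u′ (⟦⟧-order T)) border′ (+-monoʳ-≤ p m≤L)
              (≈-shift-shift⁺ {S = ⟦ T ⟧} p u′
                (subst (λ v → ⟦ P ⟧ ≈[ m ] shift v ⟦ T ⟧) (trans (+-identityʳ u) (sym u′+p≡u))
                  (proj₂ (within 0 z≤n))))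
            where
            border′ : HasBorder (shift u′ ⟦ T ⟧) (p + L) p
            border′ = IsBlockPeriod.has-border (window-blockPeriod⇒ T u′ (p + L) fits′
                        (subst₂ (λ i j → BlockPeriod (sub T i j) p) (+-∸-assoc 1 p≤u)
                           (trans (cong (_+ L) (sym u′+p≡u)) (+-assoc u′ p L)) block))

        right-maximal : length T < u + L + p ⊎ ¬ BlockPeriod (sub T (suc u) (u + L + p)) p
        right-maximal with length T <? u + L + p
        ... | yes T<end = inj₁ T<end
        ... | no T≮end = inj₂ λ block →
          no-after (subst (Occ P T) (cong (λ v → suc (u + v)) (+-comm (z * p) p))
                                                     (occursWithin⇒occ (within-next block)))
          where
          fits′ : u + (L + p) ≤ length T
          fits′ = subst (_≤ length T) (+-assoc u L p) (≮⇒≥ T≮end)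
          within-next : BlockPeriod (sub T (suc u) (u + L + p)) p →
                        OccursWithin ⟦ P ⟧ ⟦ T ⟧ m (length T) (u + (z * p + p))
          within-next block =
            ≤-trans (≤-reflexive (trans (+-assoc u _ m) (cong (u +_) (rearrange z p m)))) fits′ ,
            ≈-shift-shift⁻ {S = ⟦ T ⟧} (z * p + p) u
              (border-transport⁺ {w = z * p} border′ (≤-reflexive (rearrange z p m))
                 (≈-shift-shift⁺ {S = ⟦ T ⟧} (z * p) u (proj₂ (within z ≤-refl))))
            where
            rearrange : ∀ z p m → z * p + p + m ≡ z * p + m + p
            rearrange = solve-∀
            border′ : HasBorder (shift u ⟦ T ⟧) (L + p) p
            border′ = IsBlockPeriod.has-border (window-blockPeriod⇒ T u (L + p) fits′
                        (subst (λ j → BlockPeriod (sub T (suc u) j) p) (+-assoc u L p) block))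

        nonempty : suc u ≤ u + L
        nonempty = ≤-trans (≤-reflexive (+-comm 1 u))
                     (+-monoʳ-≤ u (≤-trans positive (≤-trans at-most-length m≤L)))

        min-block-period : MinBlockPeriod (window T u L) p
        min-block-period =
          window-blockPeriod⇐ T u L fits run-block ,
          λ q block-q → run-minimal q (window-blockPeriod⇒ T u L fits block-q)

        two-periods : 2 * p ≤ suc (u + L) ∸ suc u
        two-periods = subst (2 * p ≤_) (sym (m+n∸m≡n u L))
                        (≤-trans (≤-reflexive (cong (p +_) (+-identityʳ p))) (≤-trans p+p≤m m≤L))

        is-run : IsRun T (suc u) (u + L) p
        is-run =
          s≤s z≤n , nonempty , fits , min-block-period , two-periods , left-maximal , right-maximal

    progressions-runs : All (λ a → IsRun T (proj₁ a) (proj₁ a + proj₂ a * p + m ∸ 1) p) progressions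
    progressions-runs = All.map⁺ (All.map run-of-start starts-are-starts)
      where
      run-of-start : ∀ {s} → IsStart s → IsRun T s (s + extent s * p + m ∸ 1) p
      run-of-start {zero} ((() , _) , _)
      run-of-start {suc u} (occ , no-before) =
        subst (λ j → IsRun T (suc u) j p) (sym (+-assoc u (extent (suc u) * p) m))
          (Run.is-run (extent-all occ) no-before (extent-max (suc u)))

    private
      Gap : ℕ × ℕ → ℕ × ℕ → Set
      Gap (u₁ , z₁) (u₂ , z₂) = u₁ + z₁ * p + m < u₂ + p

      gap⇒before : ∀ {u₁ z₁ u₂ z₂} → Gap (u₁ , z₁) (u₂ , z₂) → u₁ + z₁ * p < u₂
      gap⇒before {u₁} {z₁} gap =
        +-cancelʳ-< p _ _ (≤-<-trans (+-monoʳ-≤ (u₁ + z₁ * p) (≤-trans (m≤m+n p p) p+p≤m)) gap)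

      gap⇒disjoint : ∀ {a b} → Gap a b → Disjoint p a b
      gap⇒disjoint {u₁ , z₁} {u₂ , z₂} gap i (v₁ , v₁≤z₁ , refl) (v₂ , _ , i≡) =
        <⇒≱ (gap⇒before {u₁} {z₁} {u₂} {z₂} gap)
          (≤-trans (m≤m+n u₂ (v₂ * p))
            (≤-trans (≤-reflexive (sym i≡)) (+-monoʳ-≤ u₁ (*-monoˡ-≤ p v₁≤z₁))))

      gap⇒smallOverlap : ∀ {a b} → Gap a b → SmallOverlap m p a b
      gap⇒smallOverlap {u₁ , z₁} {u₂ , z₂} gap =
        subst (λ l → (u₁ + z₁ * p + m) ⊓ (u₂ + z₂ * p + m) ∸ l < p) (sym (m≤n⇒m⊔n≡n u₁≤u₂))
          (m<n+o⇒m∸n<o _ u₂ ⦃ >-nonZero positive ⦄ (≤-<-trans (m⊓n≤m _ _) gap))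
        where
        u₁≤u₂ : u₁ ≤ u₂
        u₁≤u₂ = ≤-trans (m≤m+n u₁ (z₁ * p)) (<⇒≤ (gap⇒before {u₁} {z₁} {u₂} {z₂} gap))

    maximal-progressions : Σ (List (ℕ × ℕ)) λ L →
      All (MaxAP P T p) L ×
      (∀ i → Occ P T i → Any (λ a → InAP p (proj₁ a) (proj₂ a) i) L) ×
      AllPairs (Disjoint p) L ×
      length L * length P ≤ 2 * length T ×
      All (λ a → IsRun T (proj₁ a) (proj₁ a + proj₂ a * p + length P ∸ 1) p) L ×
      AllPairs (SmallOverlap (length P) p) L
    maximal-progressions =
      progressions , progressions-maximal , progressions-cover ,
      AllPairs.map (λ {a} {b} → gap⇒disjoint {a} {b}) progressions-gaps ,
      progressions-count , progressions-runs ,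
      AllPairs.map (λ {a} {b} → gap⇒smallOverlap {a} {b}) progressions-gaps

lemma22 : Σ ℕ λ C → (O : StrictTotalOrder 0ℓ 0ℓ 0ℓ) → let open CT O in
  (P T : String) (p : ℕ) → MinBlockPeriod P p → 4 * p ≤ length P →
  Σ (List (ℕ × ℕ)) λ L →
    All (MaxAP P T p) L ×
    (∀ i → Occ P T i → Any (λ a → InAP p (proj₁ a) (proj₂ a) i) L) ×
    AllPairs (Disjoint p) L ×
    length L * length P ≤ C * length T ×
    All (λ a → IsRun T (proj₁ a) (proj₁ a + proj₂ a * p + length P ∸ 1) p) L ×
    AllPairs (SmallOverlap (length P) p) L
lemma22 = 2 , λ where
  O [] T p ((_ , _ , ()) , _) _
  O (x ∷ xs) T p min-block 4p≤m →
    PeriodicPatternOccurrences.maximal-progressions O x xs T min-block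
      -- 4p ≤ |P| is only needed in the form 2p ≤ |P|.
      (≤-trans (+-monoʳ-≤ p (m≤m+n p (p + (p + 0)))) 4p≤m)
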